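{- Let $z_0\ge2$, $z\ge1$ and let $\tau$ be a positive integer coprime to $P(z_0)$. For every positive integer $q$, $$|w_q(z;z_0,\tau)G_\tau(z;z_0)|\le\frac{G_\tau(z^2;z_0)}{G_\tau(z;z_0)}\sum_{\substack{q_1q_2q_3=q\\ q_1q_3\le z,\ q_2q_3\le z}}\frac{1}{q_1q_2q_3}.$$
   Context: $\mu$ is the Möbius function, $\varphi$ Euler's totient, $P(z_0)=\prod_{p<z_0}p$. For a positive integer $d$ and $y>0$, $G_d(y;z_0)=\sum_{\ell\le y,\,(\ell,dP(z_0))=1}\mu^2(\ell)/\varphi(\ell)$. Let $\varphi_2(n)=\prod_{p\mid n}(p-2)$. For squarefree $q$ and $y>0$, $\xi_q(y)=\sum_{q_1q_2q_3=q,\ q_1q_3\le y,\ q_2q_3\le y}\mu(q_3)\varphi_2(q_3)/\varphi(q_3)$, and $G_{[q]}(z;z_0,\tau)=\sum_{\ell\le z/\sqrt q,\,(\ell,q\tau P(z_0))=1}\frac{\mu^2(\ell)}{\varphi(\ell)}\xi_q(z/\ell)$. For $q$ squarefree and coprime to $\tau P(z_0)$, $w_q(z;z_0,\tau)=\frac{\mu(q)}{\varphi(q)G_\tau(z;z_0)}\cdot\frac{G_{[q]}(z;z_0,\tau)}{G_\tau(z;z_0)}$; for all other $q$, $w_q(z;z_0,\tau)=0$. The sum on the right runs over ordered triples of positive integers.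
   Formalization: The parameters $z_0$ and $z$ range over the rationals. -}

module Defs where

open import Data.Bool using (Bool; true; false; _∧_; not; if_then_else_)
open import Data.Nat as ℕ using (ℕ; zero; suc; _≡ᵇ_)
open import Data.Nat.GCD using (gcd)
open import Data.Nat.Divisibility using (_∣?_)
open import Data.Nat.Primality using (prime?)
open import Data.Integer as ℤ using (ℤ; +_)
open import Data.List using (List; []; _∷_; map; upTo; filterᵇ; foldr; length)
open import Data.Rational as ℚ using (ℚ; 0ℚ; 1ℚ; _+_; _*_; -_; _/_)
open import Data.Rational.Properties using (_≤?_; _<?_; _≟_)
open import Relation.Nullary.Decidable using (⌊_⌋)
open import Relation.Nullary using (yes; no)

ι : ℕ → ℚ
ι n = (+ n) / 1

range : ℕ → List ℕ
range n = map suc (upTo n)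

-- a natural number N with N ≥ y (for y ≥ 0); every integer ℓ ≤ y lies in range (bound y)
bound : ℚ → ℕ
bound y = suc ℤ.∣ ℚ.ceiling y ∣

Σ : List ℕ → (ℕ → ℚ) → ℚ
Σ xs f = foldr (λ x acc → f x + acc) 0ℚ xs

Πℕ : List ℕ → ℕ
Πℕ = foldr ℕ._*_ 1

-- total division (x ÷ 0 := 0); only ever used with nonzero denominators
_÷_ : ℚ → ℚ → ℚ
x ÷ y with y ≟ 0ℚ
... | yes _ = 0ℚ
... | no y≢0 = x * ℚ.1/_ y {{ℚ.≢-nonZero y≢0}}

_≤ℚ_ : ℕ → ℚ → Bool
n ≤ℚ y = ⌊ ι n ≤? y ⌋

_<ℚ_ : ℕ → ℚ → Bool
n <ℚ y = ⌊ ι n <? y ⌋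

isPrime : ℕ → Bool
isPrime p = ⌊ prime? p ⌋

divides : ℕ → ℕ → Bool
divides d n = ⌊ d ∣? n ⌋

coprimeᵇ : ℕ → ℕ → Bool
coprimeᵇ a b = gcd a b ≡ᵇ 1

-- squarefree (for n ≥ 1): no d ≥ 2 with d² ∣ n
squarefree : ℕ → Bool
squarefree n = foldr (λ d acc → not (divides (suc (suc d) ℕ.* suc (suc d)) n) ∧ acc) true (upTo n)

primeDivisors : ℕ → List ℕ
primeDivisors n = filterᵇ (λ p → isPrime p ∧ divides p n) (range n)

μ : ℕ → ℤ
μ n = if squarefree n then sign (length (primeDivisors n)) else ℤ.0ℤ
  where
  sign : ℕ → ℤ
  sign zero = ℤ.1ℤ
  sign (suc k) = ℤ.- sign k

φ : ℕ → ℕ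
φ n = length (filterᵇ (λ k → coprimeᵇ k n) (range n))

φ₂ : ℕ → ℤ
φ₂ n = foldr (λ p acc → (+ p ℤ.- + 2) ℤ.* acc) ℤ.1ℤ (primeDivisors n)

μℚ : ℕ → ℚ
μℚ n = μ n / 1

P : ℚ → ℕ
P z₀ = Πℕ (filterᵇ (λ p → isPrime p ∧ (p <ℚ z₀)) (upTo (bound z₀)))

G : ℕ → ℚ → ℚ → ℚ
G d y z₀ = Σ (filterᵇ (λ ℓ → (ℓ ≤ℚ y) ∧ coprimeᵇ ℓ (d ℕ.* P z₀)) (range (bound y)))
             (λ ℓ → (μℚ ℓ * μℚ ℓ) ÷ ι (φ ℓ))

Σ₃ : ℕ → (ℕ → ℕ → ℕ → Bool) → (ℕ → ℕ → ℕ → ℚ) → ℚ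
Σ₃ q c f = Σ (range q) λ q₁ → Σ (range q) λ q₂ → Σ (range q) λ q₃ →
  if (q₁ ℕ.* q₂ ℕ.* q₃ ≡ᵇ q) ∧ c q₁ q₂ q₃ then f q₁ q₂ q₃ else 0ℚ

ξ : ℕ → ℚ → ℚ
ξ q y = Σ₃ q (λ q₁ q₂ q₃ → ((q₁ ℕ.* q₃) ≤ℚ y) ∧ ((q₂ ℕ.* q₃) ≤ℚ y))
             (λ q₁ q₂ q₃ → (μℚ q₃ * (φ₂ q₃ / 1)) ÷ ι (φ q₃))

-- G_[q](z; z₀, τ); the condition ℓ ≤ z/√q is written as ℓ²q ≤ z² (z ≥ 0)
G[_] : ℕ → ℚ → ℚ → ℕ → ℚ
G[ q ] z z₀ τ = Σ (filterᵇ (λ ℓ → ((ℓ ℕ.* ℓ ℕ.* q) ≤ℚ (z * z)) ∧ coprimeᵇ ℓ (q ℕ.* τ ℕ.* P z₀))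
                           (range (bound z)))
                  (λ ℓ → ((μℚ ℓ * μℚ ℓ) ÷ ι (φ ℓ)) * ξ q (z ÷ ι ℓ))

w : ℕ → ℚ → ℚ → ℕ → ℚ
w q z z₀ τ =
  if squarefree q ∧ coprimeᵇ q (τ ℕ.* P z₀)
  then ((μℚ q ÷ (ι (φ q) * G τ z z₀)) * (G[ q ] z z₀ τ ÷ G τ z z₀))
  else 0ℚ

{-# OPTIONS --safe #-}
module Submission where

-- Since w_q G_τ(z) = μ(q)/φ(q) · G_[q]/G_τ(z), and w_q = 0 unless q is squarefree and coprime to
-- S = τP(z₀), it suffices to prove |G_[q]| ≤ φ(q) G_τ(z²) Σ 1/(q₁q₂q₃).  The coefficients
-- μ(q₃)φ₂(q₃)/φ(q₃) of ξ_q lie in [-1, 1], because |φ₂| ≤ φ on squarefree numbers.  Exchanging the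
-- ℓ- and triple-sums, |G_[q]| is therefore at most the sum, over the triples with q₁q₃, q₂q₃ ≤ z, of
-- Σ μ²(ℓ)/φ(ℓ) over ℓ ≤ Y = z/(q₂q₃) coprime to qS.  For a prime p ∤ S, the terms ℓ and pℓ of
-- Σ_{ℓ ≤ pY, (ℓ,S) = 1} together with μ²(ℓ)/φ(ℓ) ≤ (p - 1) μ²(pℓ)/φ(pℓ) give
-- p Σ_{ℓ ≤ Y, (ℓ,pS) = 1} ≤ (p - 1) Σ_{ℓ ≤ pY, (ℓ,S) = 1}.  Removing the primes of q one at a time,
-- q Σ_{ℓ ≤ Y, (ℓ,qS) = 1} ≤ φ(q) Σ_{ℓ ≤ qY, (ℓ,S) = 1} ≤ φ(q) G_τ(z²), as qY = q₁z ≤ z².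

module Basics where

  open import Data.Bool using (Bool; true; false; T; not; if_then_else_)
  open import Data.Bool.Properties using (T?)
  open import Data.Empty using (⊥-elim)
  open import Data.Nat using (zero; suc; _+_; _*_; _≤_; z≤n; s≤s; nonTrivial⇒n>1)
  open import Data.Nat.Coprimality as Coprime using (Coprime; coprime-divisor; gcd≡1⇒coprime; coprime⇒gcd≡1)
  open import Data.Nat.Divisibility using (_∣_; _∣?_; _∣0; ∣-trans; ∣-refl; ∣m+n∣m⇒∣n; ∣m∣n⇒∣m+n)
  open import Data.Nat.GCD using (gcd; gcd[m,n]∣m; gcd[m,n]∣n)
  open import Data.Nat.Primality using (Prime; prime?; ¬prime[1]; prime⇒irreducible; prime⇒nonTrivial)
  open import Data.Nat.Properties using (≡ᵇ⇒≡; ≡⇒≡ᵇ)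
  open import Data.Product using (_,_)
  open import Data.Sum using (_⊎_; inj₁; inj₂)
  open import Relation.Binary.PropositionalEquality using (_≡_; refl; subst)
  open import Relation.Nullary using (¬_; yes; no)
  open import Relation.Nullary.Decidable using (toWitness; fromWitness; toWitnessFalse; fromWitnessFalse)
  open import Defs using (coprimeᵇ; divides; isPrime)

  T-injective : ∀ {a b : Bool} → (T a → T b) → (T b → T a) → a ≡ b
  T-injective {false} {false} _ _ = refl
  T-injective {false} {true} _ b⇒a = ⊥-elim (b⇒a _)
  T-injective {true} {false} a⇒b _ = ⊥-elim (a⇒b _)
  T-injective {true} {true} _ _ = refl

  T-case : ∀ {X : Set} b → (T b → X) → (¬ T b → X) → X
  T-case b if-true if-false with T? b
  ... | yes t = if-true t
  ... | no ¬t = if-false ¬t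

  if-T : ∀ {A : Set} b {u v : A} → T b → (if b then u else v) ≡ u
  if-T true _ = refl

  if-¬T : ∀ {A : Set} b {u v : A} → ¬ T b → (if b then u else v) ≡ v
  if-¬T true ¬t = ⊥-elim (¬t _)
  if-¬T false _ = refl

  coprimeᵇ⇒Coprime : ∀ {m n} → T (coprimeᵇ m n) → Coprime m n
  coprimeᵇ⇒Coprime {m} {n} t = gcd≡1⇒coprime (≡ᵇ⇒≡ (gcd m n) 1 t)

  Coprime⇒coprimeᵇ : ∀ {m n} → Coprime m n → T (coprimeᵇ m n)
  Coprime⇒coprimeᵇ {m} {n} c = ≡⇒≡ᵇ (gcd m n) 1 (coprime⇒gcd≡1 c)

  divides⇒∣ : ∀ {d n} → T (divides d n) → d ∣ n
  divides⇒∣ {d} {n} = toWitness {a? = d ∣? n}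

  ∣⇒divides : ∀ {d n} → d ∣ n → T (divides d n)
  ∣⇒divides {d} {n} = fromWitness {a? = d ∣? n}

  not-divides⇒∤ : ∀ {d n} → T (not (divides d n)) → ¬ d ∣ n
  not-divides⇒∤ {d} {n} = toWitnessFalse {a? = d ∣? n}

  ∤⇒not-divides : ∀ {d n} → ¬ d ∣ n → T (not (divides d n))
  ∤⇒not-divides {d} {n} = fromWitnessFalse {a? = d ∣? n}

  divides-+ˡ : ∀ p k → divides p (p + k) ≡ divides p k
  divides-+ˡ p k = T-injective
    (λ t → ∣⇒divides (∣m+n∣m⇒∣n (divides⇒∣ t) ∣-refl))
    (λ t → ∣⇒divides (∣m∣n⇒∣m+n ∣-refl (divides⇒∣ t)))

  isPrime⇒Prime : ∀ {p} → T (isPrime p) → Prime p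
  isPrime⇒Prime {p} = toWitness {a? = prime? p}

  Prime⇒isPrime : ∀ {p} → Prime p → T (isPrime p)
  Prime⇒isPrime {p} = fromWitness {a? = prime? p}

  prime⇒2≤ : ∀ {p} → Prime p → 2 ≤ p
  prime⇒2≤ {p} pp = nonTrivial⇒n>1 p {{prime⇒nonTrivial pp}}

  coprime-∣ʳ : ∀ {a c d} → Coprime a c → d ∣ c → Coprime a d
  coprime-∣ʳ a⊥c d∣c (e∣a , e∣d) = a⊥c (e∣a , ∣-trans e∣d d∣c)

  coprime-∣ˡ : ∀ {a c d} → Coprime a c → d ∣ a → Coprime d c
  coprime-∣ˡ a⊥c d∣a = Coprime.sym (coprime-∣ʳ (Coprime.sym a⊥c) d∣a)

  coprime-*ˡ : ∀ {a b c} → Coprime a c → Coprime b c → Coprime (a * b) c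
  coprime-*ˡ a⊥c b⊥c (e∣ab , e∣c) =
    b⊥c (coprime-divisor (Coprime.sym (coprime-∣ʳ a⊥c e∣c)) e∣ab , e∣c)

  coprime-*ʳ : ∀ {a b c} → Coprime a b → Coprime a c → Coprime a (b * c)
  coprime-*ʳ a⊥b a⊥c = Coprime.sym (coprime-*ˡ (Coprime.sym a⊥b) (Coprime.sym a⊥c))

  prime⇒coprime⊎∣ : ∀ {p} k → Prime p → Coprime p k ⊎ p ∣ k
  prime⇒coprime⊎∣ {p} k pp with prime⇒irreducible pp (gcd[m,n]∣m p k)
  ... | inj₁ g≡1 = inj₁ (gcd≡1⇒coprime g≡1)
  ... | inj₂ g≡p = inj₂ (subst (_∣ k) g≡p (gcd[m,n]∣n p k))

  prime∤⇒coprime : ∀ {p k} → Prime p → ¬ p ∣ k → Coprime p k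
  prime∤⇒coprime {k = k} pp p∤k with prime⇒coprime⊎∣ k pp
  ... | inj₁ p⊥k = p⊥k
  ... | inj₂ p∣k = ⊥-elim (p∤k p∣k)

  ∤⇒1≤ : ∀ {d n} → ¬ d ∣ n → 1 ≤ n
  ∤⇒1≤ {d} {zero} d∤0 = ⊥-elim (d∤0 (d ∣0))
  ∤⇒1≤ {n = suc _} _ = s≤s z≤n

  coprime⇒prime∤ : ∀ {p k} → Prime p → Coprime k p → ¬ p ∣ k
  coprime⇒prime∤ pp k⊥p p∣k with k⊥p (p∣k , ∣-refl)
  ... | refl = ¬prime[1] pp

module Ranges where

  open import Data.Bool using (Bool; true; false; T; _∧_; not)
  open import Data.Bool.Properties using (T-≡; T-∧; T?; ∧-identityʳ)
  open import Data.List using (List; []; _∷_; _++_; map; filterᵇ; length)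
  open import Data.List.Membership.Propositional using (_∈_)
  open import Data.List.Membership.Propositional.Properties using (∈-map⁺; ∈-map⁻; ∈-upTo⁺; ∈-upTo⁻)
  open import Data.List.Properties using (map-id; map-upTo; map-++; map-∘; filter-++; length-++; filter-none)
  open import Data.List.Relation.Unary.All using (tabulate)
  open import Data.List.Relation.Unary.Any using (here; there)
  open import Data.List.Relation.Unary.Unique.Propositional using (Unique)
  open import Data.List.Relation.Unary.Unique.Propositional.Properties using (map⁺; upTo⁺)
  open import Data.Nat using (NonZero; >-nonZero; ℕ; zero; suc; _+_; _*_; _≤_; z≤n; s≤s)
  open import Data.Nat.Divisibility using (∣⇒≤; ∣-refl)
  open import Data.Nat.Properties using (+-comm; +-suc; *-suc; *-identityʳ; suc-injective; <-irrefl; ≤-trans)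
  open import Data.Product using (_×_; _,_)
  open import Function using (Equivalence; _∘_)
  open import Relation.Binary.PropositionalEquality
  open import Relation.Nullary using (¬_)
  open import Defs using (range; divides)
  open ≡-Reasoning
  open Basics

  range-suc : ∀ n → range (suc n) ≡ 1 ∷ map suc (range n)
  range-suc n = cong (λ xs → 1 ∷ map suc xs) (sym (map-upTo suc n))

  range-+ : ∀ m n → range (m + n) ≡ range m ++ map (m +_) (range n)
  range-+ zero n = sym (map-id (range n))
  range-+ (suc m) n = begin
    range (suc (m + n))                                          ≡⟨ range-suc (m + n) ⟩
    1 ∷ map suc (range (m + n))
      ≡⟨ cong (λ xs → 1 ∷ map suc xs) (range-+ m n) ⟩
    1 ∷ map suc (range m ++ map (m +_) (range n))                ≡⟨ cong (1 ∷_) (map-++ suc (range m) _) ⟩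
    1 ∷ (map suc (range m) ++ map suc (map (m +_) (range n)))
      ≡⟨ cong (λ xs → 1 ∷ (map suc (range m) ++ xs)) (sym (map-∘ (range n))) ⟩
    1 ∷ (map suc (range m) ++ map (suc m +_) (range n))
      ≡⟨ cong (_++ map (suc m +_) (range n)) (sym (range-suc m)) ⟩
    range (suc m) ++ map (suc m +_) (range n)                    ∎

  ∈-range⁻ : ∀ {n x} → x ∈ range n → 1 ≤ x × x ≤ n
  ∈-range⁻ x∈ with ∈-map⁻ suc x∈
  ... | k , k∈ , refl = s≤s z≤n , ∈-upTo⁻ k∈

  ∈-range⁺ : ∀ {n x} → 1 ≤ x → x ≤ n → x ∈ range n
  ∈-range⁺ {x = suc k} _ k<n = ∈-map⁺ suc (∈-upTo⁺ k<n)

  range-unique : ∀ n → Unique (range n)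
  range-unique n = map⁺ suc-injective (upTo⁺ n)

  count : (ℕ → Bool) → ℕ → ℕ
  count c n = length (filterᵇ c (range n))

  private
    length-filterᵇ-map : ∀ (c : ℕ → Bool) (g : ℕ → ℕ) xs →
      length (filterᵇ c (map g xs)) ≡ length (filterᵇ (c ∘ g) xs)
    length-filterᵇ-map c g [] = refl
    length-filterᵇ-map c g (x ∷ xs) with c (g x)
    ... | true = cong suc (length-filterᵇ-map c g xs)
    ... | false = length-filterᵇ-map c g xs

    length-filterᵇ-cong : ∀ {c c′ : ℕ → Bool} xs → (∀ {x} → x ∈ xs → c x ≡ c′ x) →
      length (filterᵇ c xs) ≡ length (filterᵇ c′ xs)
    length-filterᵇ-cong [] _ = refl
    length-filterᵇ-cong {c} {c′} (x ∷ xs) c≗c′ with c x | c′ x | c≗c′ (here refl)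
    ... | true | true | refl = cong suc (length-filterᵇ-cong xs (c≗c′ ∘ there))
    ... | false | false | refl = length-filterᵇ-cong xs (c≗c′ ∘ there)

    length-filterᵇ-split : ∀ (c b : ℕ → Bool) xs → length (filterᵇ c xs) ≡
      length (filterᵇ (λ x → c x ∧ b x) xs) + length (filterᵇ (λ x → c x ∧ not (b x)) xs)
    length-filterᵇ-split c b [] = refl
    length-filterᵇ-split c b (x ∷ xs) with c x | b x
    ... | true | true = cong suc (length-filterᵇ-split c b xs)
    ... | true | false = trans (cong suc (length-filterᵇ-split c b xs)) (sym (+-suc _ _))
    ... | false | _ = length-filterᵇ-split c b xs

  count-+ : ∀ c m n → count c (m + n) ≡ count c m + count (λ k → c (m + k)) n
  count-+ c m n = begin
    length (filterᵇ c (range (m + n)))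
      ≡⟨ cong (length ∘ filterᵇ c) (range-+ m n) ⟩
    length (filterᵇ c (range m ++ map (m +_) (range n)))
      ≡⟨ cong length (filter-++ _ (range m) _) ⟩
    length (filterᵇ c (range m) ++ filterᵇ c (map (m +_) (range n)))     ≡⟨ length-++ (filterᵇ c (range m)) ⟩
    count c m + length (filterᵇ c (map (m +_) (range n)))
      ≡⟨ cong (count c m +_) (length-filterᵇ-map c (m +_) (range n)) ⟩
    count c m + count (λ k → c (m + k)) n                                ∎

  count-cong : ∀ {c c′} n → (∀ {k} → k ∈ range n → c k ≡ c′ k) → count c n ≡ count c′ n
  count-cong n = length-filterᵇ-cong (range n)

  count-split : ∀ c b n → count c n ≡ count (λ k → c k ∧ b k) n + count (λ k → c k ∧ not (b k)) n
  count-split c b n = length-filterᵇ-split c b (range n)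

  count-periodic : ∀ c m → (∀ k → c (m + k) ≡ c k) → ∀ j → count c (j * m) ≡ j * count c m
  count-periodic c m periodic zero = refl
  count-periodic c m periodic (suc j) = begin
    count c (m + j * m)                         ≡⟨ count-+ c m (j * m) ⟩
    count c m + count (λ k → c (m + k)) (j * m)
      ≡⟨ cong (count c m +_) (count-cong (j * m) (λ {k} _ → periodic k)) ⟩
    count c m + count c (j * m)                 ≡⟨ cong (count c m +_) (count-periodic c m periodic j) ⟩
    count c m + j * count c m                   ∎

  count-none : ∀ {c} n → (∀ {k} → k ∈ range n → ¬ T (c k)) → count c n ≡ 0
  count-none {c} n none = cong length (filter-none (T? ∘ c) (tabulate none))

  private
    count-multiples-1 : ∀ (c : ℕ → Bool) p′ →
      count (λ k → c k ∧ divides (suc p′) k) (suc p′) ≡ count (λ j → c (suc p′ * j)) 1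
    count-multiples-1 c p′ = begin
      count C (suc p′)                           ≡⟨ cong (count C) (+-comm 1 p′) ⟩
      count C (p′ + 1)                           ≡⟨ count-+ C p′ 1 ⟩
      count C p′ + count (λ k → C (p′ + k)) 1
        ≡⟨ cong (_+ count (λ k → C (p′ + k)) 1) (count-none p′ below-p) ⟩
      count (λ k → C (p′ + k)) 1                 ≡⟨ count-cong 1 at-p ⟩
      count (λ j → c (p * j)) 1                  ∎
      where
      p = suc p′
      C = λ k → c k ∧ divides p k
      below-p : ∀ {k} → k ∈ range p′ → ¬ T (C k)
      below-p {k} k∈ t with ∈-range⁻ k∈ | Equivalence.to T-∧ t
      ... | 1≤k , k≤p′ | _ , p∣k = <-irrefl refl (≤-trans (s≤s k≤p′) (∣⇒≤ {{>-nonZero 1≤k}} (divides⇒∣ p∣k)))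
      at-p : ∀ {k} → k ∈ range 1 → C (p′ + k) ≡ c (p * k)
      at-p (here refl) = begin
        c (p′ + 1) ∧ divides p (p′ + 1) ≡⟨ cong (λ k → c k ∧ divides p k) (+-comm p′ 1) ⟩
        c p ∧ divides p p               ≡⟨ cong (c p ∧_) (Equivalence.to T-≡ (∣⇒divides ∣-refl)) ⟩
        c p ∧ true                      ≡⟨ ∧-identityʳ (c p) ⟩
        c p                             ≡⟨ cong c (sym (*-identityʳ p)) ⟩
        c (p * 1)                       ∎

  count-multiples : ∀ (c : ℕ → Bool) p .{{_ : NonZero p}} n →
    count (λ k → c k ∧ divides p k) (n * p) ≡ count (λ j → c (p * j)) n
  count-multiples c p@(suc p′) zero = refl
  count-multiples c p@(suc p′) (suc n) = begin
    count C (p + n * p)                                          ≡⟨ count-+ C p (n * p) ⟩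
    count C p + count (λ k → C (p + k)) (n * p)
      ≡⟨ cong₂ _+_ (count-multiples-1 c p′) shifted ⟩
    count (λ j → c (p * j)) 1 + count (λ j → c (p + p * j)) n
      ≡⟨ cong (count (λ j → c (p * j)) 1 +_) (count-cong n (λ {j} _ → cong c (sym (*-suc p j)))) ⟩
    count (λ j → c (p * j)) 1 + count (λ j → c (p * suc j)) n    ≡⟨ sym (count-+ (λ j → c (p * j)) 1 n) ⟩
    count (λ j → c (p * j)) (suc n)                              ∎
    where
    C = λ k → c k ∧ divides p k
    shifted : count (λ k → C (p + k)) (n * p) ≡ count (λ j → c (p + p * j)) n
    shifted = trans (count-cong (n * p) (λ {k} _ → cong (c (p + k) ∧_) (divides-+ˡ p k)))
                    (count-multiples (λ k → c (p + k)) p n)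

module SquareFree where

  open import Data.Bool using (Bool; T; _∧_; not; true)
  open import Data.Bool.Properties using (T-∧)
  open import Data.List using (List; []; _∷_; foldr; upTo)
  open import Data.List.Membership.Propositional using (_∈_)
  open import Data.List.Membership.Propositional.Properties using (∈-upTo⁺)
  open import Data.List.Relation.Unary.All using (_∷_)
  open import Data.List.Relation.Unary.Any using (here; there)
  open import Data.Nat using (ℕ; zero; suc; _+_; _*_; _≤_; _<_; z≤n; s≤s; >-nonZero)
  open import Data.Nat.Coprimality as Coprime using (coprime-divisor)
  open import Data.Nat.Divisibility using (_∣_; ∣⇒≤; ∣-trans; *-pres-∣; *-cancelˡ-∣; *-monoʳ-∣; n∣m*n)
  open import Data.Nat.Induction using (<-rec)
  open import Data.Nat.ListAction using (product)
  open import Data.Nat.Primality using (Prime; prime⇒nonZero)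
  open import Data.Nat.Primality.Factorisation using (factorise)
  open import Data.Nat.Properties using (_<?_; ≮⇒≥; <-≤-trans; ≤-trans; <-irrefl; m<n+m; m≤m*n; m<m*n; *-comm)
  open import Data.Product using (_,_; proj₁; proj₂)
  open import Data.Sum using (inj₁; inj₂)
  open import Function using (Equivalence)
  open import Relation.Binary.PropositionalEquality
  open import Relation.Nullary using (¬_; yes; no)
  open import Defs using (squarefree; divides)
  open Basics

  SquareFree : ℕ → Set
  SquareFree n = ∀ k → ¬ (2 + k) * (2 + k) ∣ n

  private
    T-all⁻ : ∀ (b : ℕ → Bool) {xs} → T (foldr (λ d acc → b d ∧ acc) true xs) → ∀ {d} → d ∈ xs → T (b d)
    T-all⁻ b {x ∷ _} t (here refl) = proj₁ (Equivalence.to T-∧ t)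
    T-all⁻ b {x ∷ _} t (there d∈) = T-all⁻ b (proj₂ (Equivalence.to T-∧ t)) d∈

    T-all⁺ : ∀ (b : ℕ → Bool) xs → (∀ d → T (b d)) → T (foldr (λ d acc → b d ∧ acc) true xs)
    T-all⁺ b [] _ = _
    T-all⁺ b (x ∷ xs) all = Equivalence.from T-∧ (all x , T-all⁺ b xs all)

  squarefree⇒SquareFree : ∀ {n} → 1 ≤ n → T (squarefree n) → SquareFree n
  squarefree⇒SquareFree {n} 1≤n t k k²∣n with k <? n
  ... | yes k<n = not-divides⇒∤ (T-all⁻ (λ d → not (divides ((2 + d) * (2 + d)) n)) t (∈-upTo⁺ k<n)) k²∣n
  ... | no k≮n = <-irrefl refl (<-≤-trans k<k² (≤-trans (∣⇒≤ {{>-nonZero 1≤n}} k²∣n) (≮⇒≥ k≮n)))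
    where
    k<k² : k < (2 + k) * (2 + k)
    k<k² = <-≤-trans (m<n+m k {2} (s≤s z≤n)) (m≤m*n (2 + k) (2 + k))

  SquareFree⇒squarefree : ∀ {n} → SquareFree n → T (squarefree n)
  SquareFree⇒squarefree {n} sf = T-all⁺ _ (upTo n) (λ k → ∤⇒not-divides (sf k))

  square∤ : ∀ {d n} → 2 ≤ d → SquareFree n → ¬ d * d ∣ n
  square∤ {suc (suc k)} _ sf = sf k
  square∤ {suc zero} (s≤s ())

  SquareFree-∣ : ∀ {m n} → m ∣ n → SquareFree n → SquareFree m
  SquareFree-∣ m∣n sf k k²∣m = sf k (∣-trans k²∣m m∣n)

  SquareFree-*prime : ∀ {p m} → Prime p → ¬ p ∣ m → SquareFree m → SquareFree (p * m)
  SquareFree-*prime {p} pp p∤m sf k k²∣pm with prime⇒coprime⊎∣ (2 + k) pp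
  ... | inj₂ p∣d = p∤m (*-cancelˡ-∣ p {{prime⇒nonZero pp}} (∣-trans (*-pres-∣ p∣d p∣d) k²∣pm))
  ... | inj₁ p⊥d = sf k (coprime-divisor (coprime-*ˡ (Coprime.sym p⊥d) (Coprime.sym p⊥d)) k²∣pm)

  SquareFree-induction : ∀ (P : ℕ → Set) → P 1 →
    (∀ {p m} → Prime p → ¬ p ∣ m → SquareFree m → P m → P (p * m)) →
    ∀ {q} → 1 ≤ q → SquareFree q → P q
  SquareFree-induction P base step {q} = <-rec (λ q → 1 ≤ q → SquareFree q → P q) induct q
    where
    induct : ∀ q → (∀ {m} → m < q → 1 ≤ m → SquareFree m → P m) → 1 ≤ q → SquareFree q → P q
    induct 1 _ _ _ = base
    induct q@(suc (suc _)) smaller _ sf with factorise q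
    ... | record { factors = [] ; isFactorisation = () }
    ... | record { factors = p ∷ ps ; isFactorisation = q≡pm ; factorsPrime = pp ∷ _ } =
      subst P (sym q≡pm) (step pp p∤m sf-m (smaller m<q 1≤m sf-m))
      where
      m = product ps
      p∤m : ¬ p ∣ m
      p∤m p∣m = square∤ (prime⇒2≤ pp) sf (subst (p * p ∣_) (sym q≡pm) (*-monoʳ-∣ p p∣m))
      1≤m = ∤⇒1≤ p∤m
      sf-m : SquareFree m
      sf-m = SquareFree-∣ (subst (m ∣_) (sym q≡pm) (n∣m*n p)) sf
      m<q : m < q
      m<q = subst (m <_) (trans (*-comm m p) (sym q≡pm)) (m<m*n m p {{>-nonZero 1≤m}} (prime⇒2≤ pp))

module Totient where

  open import Data.Bool using (Bool; _∧_; not)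
  open import Data.Bool.Properties using (T-∧; T?)
  open import Data.List.Membership.Propositional using (lose)
  open import Data.List.Properties using (filter-some)
  open import Data.Nat using (suc; _+_; _*_; _∸_; _≤_; s≤s; z≤n)
  open import Data.Nat.Coprimality as Coprime using (Coprime; 1-coprimeTo)
  open import Data.Nat.Divisibility using (_∣_; ∣m+n∣m⇒∣n; ∣m∣n⇒∣m+n; n∣m*n; m∣m*n; ∣n⇒∣m*n)
  open import Data.Nat.Primality using (Prime)
  open import Data.Nat.Properties using (*-comm; +-cancelˡ-≡)
  open import Data.Product using (_,_)
  open import Function using (_∘_; Equivalence)
  open import Relation.Binary.PropositionalEquality
  open import Relation.Nullary using (¬_)
  open import Defs using (φ; coprimeᵇ; divides)
  open ≡-Reasoning
  open Basics
  open Ranges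

  coprimeᵇ-+ˡ : ∀ m k → coprimeᵇ (m + k) m ≡ coprimeᵇ k m
  coprimeᵇ-+ˡ m k = T-injective
    (λ t → Coprime⇒coprimeᵇ λ (d∣k , d∣m) → coprimeᵇ⇒Coprime {m + k} t (∣m∣n⇒∣m+n d∣m d∣k , d∣m))
    (λ t → Coprime⇒coprimeᵇ λ (d∣m+k , d∣m) → coprimeᵇ⇒Coprime {k} t (∣m+n∣m⇒∣n d∣m+k d∣m , d∣m))

  coprimeᵇ-*ˡ : ∀ {p m} j → Coprime p m → coprimeᵇ (p * j) m ≡ coprimeᵇ j m
  coprimeᵇ-*ˡ {p} j p⊥m = T-injective
    (λ t → Coprime⇒coprimeᵇ λ (d∣j , d∣m) → coprimeᵇ⇒Coprime {p * j} t (∣n⇒∣m*n p d∣j , d∣m))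
    (λ t → Coprime⇒coprimeᵇ (coprime-*ˡ p⊥m (coprimeᵇ⇒Coprime {j} t)))

  coprimeᵇ-prime*ʳ : ∀ {p} m k → Prime p → coprimeᵇ k (p * m) ≡ coprimeᵇ k m ∧ not (divides p k)
  coprimeᵇ-prime*ʳ {p} m k pp = T-injective
    (λ t → let k⊥pm = coprimeᵇ⇒Coprime {k} t in Equivalence.from T-∧
      ( Coprime⇒coprimeᵇ (coprime-∣ʳ k⊥pm (n∣m*n p))
      , ∤⇒not-divides (coprime⇒prime∤ pp (coprime-∣ʳ k⊥pm (m∣m*n m)))))
    (λ t → let (k⊥m , p∤k) = Equivalence.to T-∧ t in Coprime⇒coprimeᵇ
      (coprime-*ʳ (Coprime.sym (prime∤⇒coprime pp (not-divides⇒∤ p∤k))) (coprimeᵇ⇒Coprime {k} k⊥m)))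

  -- The k ≤ pm coprime to m number p φ(m) by periodicity; those divisible by p are the pj with
  -- j ≤ m coprime to m, and the others are those coprime to pm.  Hence φ(m) + φ(pm) = p φ(m).
  φ-*-prime : ∀ {p m} → Prime p → ¬ p ∣ m → φ (p * m) ≡ (p ∸ 1) * φ m
  φ-*-prime {p@(suc p′)} {m} pp p∤m = +-cancelˡ-≡ (φ m) _ _ (begin
    φ m + φ (p * m)
      ≡⟨ cong₂ _+_ (sym (count-cong m (λ {j} _ → coprimeᵇ-*ˡ j p⊥m)))
                   (count-cong (p * m) (λ {k} _ → coprimeᵇ-prime*ʳ m k pp)) ⟩
    count (λ j → cop (p * j)) m + count (λ k → cop k ∧ not (divides p k)) (p * m)
      ≡⟨ cong (_+ count (λ k → cop k ∧ not (divides p k)) (p * m)) (sym (count-multiples cop p m)) ⟩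
    count (λ k → cop k ∧ divides p k) (m * p) + count (λ k → cop k ∧ not (divides p k)) (p * m)
      ≡⟨ cong (λ n → count (λ k → cop k ∧ divides p k) n + count (λ k → cop k ∧ not (divides p k)) (p * m))
              (*-comm m p) ⟩
    count (λ k → cop k ∧ divides p k) (p * m) + count (λ k → cop k ∧ not (divides p k)) (p * m)
      ≡⟨ sym (count-split cop (divides p) (p * m)) ⟩
    count cop (p * m)
      ≡⟨ count-periodic cop m (coprimeᵇ-+ˡ m) p ⟩
    φ m + p′ * φ m ∎)
    where
    cop = λ k → coprimeᵇ k m
    p⊥m = prime∤⇒coprime pp p∤m

  φ-pos : ∀ {n} → 1 ≤ n → 1 ≤ φ n
  φ-pos {n} 1≤n = filter-some (T? ∘ λ k → coprimeᵇ k n)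
    (lose (∈-range⁺ (s≤s z≤n) 1≤n) (Coprime⇒coprimeᵇ (1-coprimeTo n)))

module TotientTwo where

  open import Data.Bool using (Bool; true; false; T; _∧_; _∨_; if_then_else_)
  open import Data.Bool.Properties using (T-∧; T-∨)
  open import Data.Empty using (⊥-elim)
  open import Data.Integer as ℤ using (ℤ; +_; 1ℤ; ∣_∣)
  open import Data.Integer.Properties
    using (*-identityˡ; *-identityʳ; *-assoc; ∣i*j∣≡∣i∣*∣j∣; *-commutativeSemigroup)
  open import Data.List using (List; []; _∷_; _++_; map; filterᵇ; foldr)
  open import Data.List.Membership.Propositional using (_∈_)
  open import Data.List.Membership.Propositional.Properties using (∈-map⁻)
  open import Data.List.Relation.Unary.Any using (here; there)
  open import Data.Nat as ℕ using (ℕ; suc; _+_; _∸_; _≤_; z≤n; s≤s; >-nonZero)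
  open import Data.Nat.Coprimality using (Coprime)
  open import Data.Nat.Divisibility using (_∣_; ∣⇒≤; ∣n⇒∣m*n; m∣m*n; ∣-trans; ∣-refl)
  open import Data.Nat.Primality using (Prime; euclidsLemma; prime⇒irreducible; ¬prime[1])
  open import Data.Nat.Properties
    using (module ≤-Reasoning; ≤-refl; +-comm; m+[n∸m]≡n; m≤m*n; m≤n*m; *-mono-≤; n≤1+n; <-irrefl; ≤-trans; m<m+n)
  open import Data.Product using (_×_; _,_; proj₁; proj₂)
  open import Data.Sum using (inj₁; inj₂)
  open import Function using (_∘_; Equivalence; case_of_)
  open import Relation.Binary.PropositionalEquality
  open import Relation.Nullary using (¬_)
  open import Algebra.Properties.CommutativeSemigroup *-commutativeSemigroup using (interchange)
  open import Defs using (φ; φ₂; range; isPrime; divides)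
  open Basics
  open Ranges
  open Totient
  open SquareFree

  ∏ : List ℕ → (ℕ → ℤ) → ℤ
  ∏ xs h = foldr (λ x acc → h x ℤ.* acc) 1ℤ xs

  ∏-filterᵇ : ∀ (c : ℕ → Bool) h xs → ∏ (filterᵇ c xs) h ≡ ∏ xs (λ x → if c x then h x else 1ℤ)
  ∏-filterᵇ c h [] = refl
  ∏-filterᵇ c h (x ∷ xs) with c x
  ... | true = cong (h x ℤ.*_) (∏-filterᵇ c h xs)
  ... | false = trans (∏-filterᵇ c h xs) (sym (*-identityˡ _))

  ∏-++ : ∀ xs ys h → ∏ (xs ++ ys) h ≡ ∏ xs h ℤ.* ∏ ys h
  ∏-++ [] ys h = sym (*-identityˡ _)
  ∏-++ (x ∷ xs) ys h = trans (cong (h x ℤ.*_) (∏-++ xs ys h)) (sym (*-assoc (h x) _ _))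

  ∏-* : ∀ xs (a b : ℕ → ℤ) → ∏ xs (λ x → a x ℤ.* b x) ≡ ∏ xs a ℤ.* ∏ xs b
  ∏-* [] a b = refl
  ∏-* (x ∷ xs) a b = trans (cong (a x ℤ.* b x ℤ.*_) (∏-* xs a b)) (interchange (a x) (b x) _ _)

  ∏-cong : ∀ xs {a b : ℕ → ℤ} → (∀ x → a x ≡ b x) → ∏ xs a ≡ ∏ xs b
  ∏-cong [] _ = refl
  ∏-cong (x ∷ xs) a≗b = cong₂ ℤ._*_ (a≗b x) (∏-cong xs a≗b)

  ∏-ones : ∀ xs {h : ℕ → ℤ} → (∀ {x} → x ∈ xs → h x ≡ 1ℤ) → ∏ xs h ≡ 1ℤ
  ∏-ones [] _ = refl
  ∏-ones (x ∷ xs) ones = trans (cong₂ ℤ._*_ (ones (here refl)) (∏-ones xs (ones ∘ there))) (*-identityˡ 1ℤ)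

  isPrimeFactor : ℕ → ℕ → Bool
  isPrimeFactor n x = isPrime x ∧ divides x n

  φ₂-factor : ℕ → ℕ → ℤ
  φ₂-factor n x = if isPrimeFactor n x then + x ℤ.- + 2 else 1ℤ

  φ₂-over-range : ∀ {n N} → 1 ≤ n → n ≤ N → φ₂ n ≡ ∏ (range N) (φ₂-factor n)
  φ₂-over-range {n} {N} 1≤n n≤N = begin
    φ₂ n
      ≡⟨ ∏-filterᵇ (isPrimeFactor n) (λ x → + x ℤ.- + 2) (range n) ⟩
    ∏ (range n) (φ₂-factor n)
      ≡⟨ sym (*-identityʳ (∏ (range n) (φ₂-factor n))) ⟩
    ∏ (range n) (φ₂-factor n) ℤ.* 1ℤ
      ≡⟨ cong (∏ (range n) (φ₂-factor n) ℤ.*_) (sym (∏-ones _ {φ₂-factor n} beyond-n)) ⟩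
    ∏ (range n) (φ₂-factor n) ℤ.* ∏ (map (λ k → n + k) (range (N ∸ n))) (φ₂-factor n)
      ≡⟨ sym (∏-++ (range n) _ (φ₂-factor n)) ⟩
    ∏ (range n ++ map (λ k → n + k) (range (N ∸ n))) (φ₂-factor n)
      ≡⟨ cong (λ xs → ∏ xs (φ₂-factor n)) (sym (range-+ n (N ∸ n))) ⟩
    ∏ (range (n + (N ∸ n))) (φ₂-factor n)
      ≡⟨ cong (λ k → ∏ (range k) (φ₂-factor n)) (m+[n∸m]≡n n≤N) ⟩
    ∏ (range N) (φ₂-factor n)
      ∎
    where
    open ≡-Reasoning
    beyond-n : ∀ {x} → x ∈ map (λ k → n + k) (range (N ∸ n)) → φ₂-factor n x ≡ 1ℤ
    beyond-n x∈ with ∈-map⁻ (λ k → n + k) x∈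
    ... | k , k∈ , refl = if-¬T (isPrimeFactor n (n + k)) λ t →
      <-irrefl refl (≤-trans (m<m+n n (proj₁ (∈-range⁻ k∈)))
                             (∣⇒≤ {{>-nonZero 1≤n}} (divides⇒∣ (proj₂ (Equivalence.to T-∧ t)))))

  isPrimeFactor⁻ : ∀ {n x} → T (isPrimeFactor n x) → Prime x × x ∣ n
  isPrimeFactor⁻ {n} {x} t =
    let (px , x∣n) = Equivalence.to (T-∧ {isPrime x}) t in isPrime⇒Prime px , divides⇒∣ x∣n

  isPrimeFactor⁺ : ∀ {n x} → Prime x → x ∣ n → T (isPrimeFactor n x)
  isPrimeFactor⁺ px x∣n = Equivalence.from T-∧ (Prime⇒isPrime px , ∣⇒divides x∣n)

  isPrimeFactor-* : ∀ m n x → isPrimeFactor (m ℕ.* n) x ≡ isPrimeFactor m x ∨ isPrimeFactor n x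
  isPrimeFactor-* m n x = T-injective to from
    where
    to : T (isPrimeFactor (m ℕ.* n) x) → T (isPrimeFactor m x ∨ isPrimeFactor n x)
    to t with isPrimeFactor⁻ {m ℕ.* n} {x} t
    ... | px , x∣mn with euclidsLemma m n px x∣mn
    ...   | inj₁ x∣m = Equivalence.from T-∨ (inj₁ (isPrimeFactor⁺ {m} px x∣m))
    ...   | inj₂ x∣n = Equivalence.from (T-∨ {isPrimeFactor m x}) (inj₂ (isPrimeFactor⁺ {n} px x∣n))
    from : T (isPrimeFactor m x ∨ isPrimeFactor n x) → T (isPrimeFactor (m ℕ.* n) x)
    from t with Equivalence.to (T-∨ {isPrimeFactor m x}) t
    ... | inj₁ t′ = let (px , x∣m) = isPrimeFactor⁻ {m} {x} t′ in
      isPrimeFactor⁺ {m ℕ.* n} px (∣-trans x∣m (m∣m*n n))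
    ... | inj₂ t′ = let (px , x∣n) = isPrimeFactor⁻ {n} {x} t′ in
      isPrimeFactor⁺ {m ℕ.* n} px (∣n⇒∣m*n m x∣n)

  φ₂-factor-* : ∀ {m n} x → Coprime m n → φ₂-factor (m ℕ.* n) x ≡ φ₂-factor m x ℤ.* φ₂-factor n x
  φ₂-factor-* {m} {n} x m⊥n = trans (cong (λ b → if b then g else 1ℤ) (isPrimeFactor-* m n x))
    (split (isPrimeFactor m x) (isPrimeFactor n x) not-both)
    where
    g = + x ℤ.- + 2
    not-both : ¬ (T (isPrimeFactor m x) × T (isPrimeFactor n x))
    not-both (tm , tn) with isPrimeFactor⁻ {m} {x} tm | isPrimeFactor⁻ {n} {x} tn
    ... | px , x∣m | _ , x∣n = ¬prime[1] (subst Prime (m⊥n (x∣m , x∣n)) px)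
    split : ∀ a b → ¬ (T a × T b) → (if a ∨ b then g else 1ℤ) ≡ (if a then g else 1ℤ) ℤ.* (if b then g else 1ℤ)
    split true true ¬both = ⊥-elim (¬both (_ , _))
    split true false _ = sym (*-identityʳ g)
    split false true _ = sym (*-identityˡ g)
    split false false _ = refl

  φ₂-* : ∀ {m n} → Coprime m n → 1 ≤ m → 1 ≤ n → φ₂ (m ℕ.* n) ≡ φ₂ m ℤ.* φ₂ n
  φ₂-* {m} {n} m⊥n 1≤m 1≤n = begin
    φ₂ (m ℕ.* n)
      ≡⟨ φ₂-over-range (*-mono-≤ 1≤m 1≤n) ≤-refl ⟩
    ∏ (range (m ℕ.* n)) (φ₂-factor (m ℕ.* n))
      ≡⟨ ∏-cong (range (m ℕ.* n)) (λ x → φ₂-factor-* x m⊥n) ⟩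
    ∏ (range (m ℕ.* n)) (λ x → φ₂-factor m x ℤ.* φ₂-factor n x)
      ≡⟨ ∏-* (range (m ℕ.* n)) (φ₂-factor m) (φ₂-factor n) ⟩
    ∏ (range (m ℕ.* n)) (φ₂-factor m) ℤ.* ∏ (range (m ℕ.* n)) (φ₂-factor n)
      ≡⟨ sym (cong₂ ℤ._*_ (φ₂-over-range 1≤m (m≤m*n m n {{>-nonZero 1≤n}}))
                          (φ₂-over-range 1≤n (m≤n*m n m {{>-nonZero 1≤m}}))) ⟩
    φ₂ m ℤ.* φ₂ n
      ∎
    where open ≡-Reasoning

  φ₂-prime : ∀ {p} → Prime p → φ₂ p ≡ + p ℤ.- + 2
  φ₂-prime {p@(suc p′)} pp = begin
    φ₂ p                                          ≡⟨ φ₂-over-range {p} (s≤s z≤n) ≤-refl ⟩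
    ∏ (range p) (φ₂-factor p)                     ≡⟨ cong (λ k → ∏ (range k) (φ₂-factor p)) (+-comm 1 p′) ⟩
    ∏ (range (p′ + 1)) (φ₂-factor p)              ≡⟨ cong (λ xs → ∏ xs (φ₂-factor p)) (range-+ p′ 1) ⟩
    ∏ (range p′ ++ p′ + 1 ∷ []) (φ₂-factor p)     ≡⟨ ∏-++ (range p′) _ (φ₂-factor p) ⟩
    ∏ (range p′) (φ₂-factor p) ℤ.* (φ₂-factor p (p′ + 1) ℤ.* 1ℤ)
      ≡⟨ cong₂ ℤ._*_ (∏-ones (range p′) below-p) (*-identityʳ _) ⟩
    1ℤ ℤ.* φ₂-factor p (p′ + 1)                   ≡⟨ *-identityˡ _ ⟩
    φ₂-factor p (p′ + 1)                          ≡⟨ cong (φ₂-factor p) (+-comm p′ 1) ⟩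
    φ₂-factor p p                                 ≡⟨ if-T (isPrimeFactor p p) (isPrimeFactor⁺ {p} pp ∣-refl) ⟩
    + p ℤ.- + 2                                   ∎
    where
    open ≡-Reasoning
    below-p : ∀ {x} → x ∈ range p′ → φ₂-factor p x ≡ 1ℤ
    below-p {x} x∈ = if-¬T (isPrimeFactor p x) λ t → let (px , x∣p) = isPrimeFactor⁻ {p} {x} t in
      case prime⇒irreducible pp x∣p of λ where
        (inj₁ refl) → ¬prime[1] px
        (inj₂ refl) → <-irrefl refl (s≤s (proj₂ (∈-range⁻ x∈)))

  ∣φ₂∣≤φ : ∀ {n} → 1 ≤ n → SquareFree n → ∣ φ₂ n ∣ ≤ φ n
  ∣φ₂∣≤φ = SquareFree-induction (λ n → ∣ φ₂ n ∣ ≤ φ n) (s≤s z≤n) step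
    where
    open ≤-Reasoning
    step : ∀ {p m} → Prime p → ¬ p ∣ m → SquareFree m → ∣ φ₂ m ∣ ≤ φ m → ∣ φ₂ (p ℕ.* m) ∣ ≤ φ (p ℕ.* m)
    step {p@(suc (suc k))} {m} pp p∤m _ ih = begin
      ∣ φ₂ (p ℕ.* m) ∣      ≡⟨ cong ∣_∣ (φ₂-* (prime∤⇒coprime pp p∤m) (s≤s z≤n) (∤⇒1≤ p∤m)) ⟩
      ∣ φ₂ p ℤ.* φ₂ m ∣     ≡⟨ ∣i*j∣≡∣i∣*∣j∣ (φ₂ p) (φ₂ m) ⟩
      ∣ φ₂ p ∣ ℕ.* ∣ φ₂ m ∣ ≡⟨ cong (λ a → ∣ a ∣ ℕ.* ∣ φ₂ m ∣) (φ₂-prime pp) ⟩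
      k ℕ.* ∣ φ₂ m ∣        ≤⟨ *-mono-≤ (n≤1+n k) ih ⟩
      suc k ℕ.* φ m         ≡⟨ sym (φ-*-prime pp p∤m) ⟩
      φ (p ℕ.* m)           ∎

module ListSums where

  open import Algebra.Bundles using (CommutativeMonoid)
  open import Data.Bool using (Bool; true; false; if_then_else_)
  open import Data.Empty using (⊥-elim)
  open import Data.List using (List; []; _∷_; _++_; map; filterᵇ)
  open import Data.List.Membership.Propositional using (_∈_)
  open import Data.List.Membership.Propositional.Properties using (∈-∃++; ∈-++⁻; ∈-++⁺ˡ; ∈-++⁺ʳ)
  open import Data.List.Relation.Unary.All using (lookup)
  open import Data.List.Relation.Unary.AllPairs using (_∷_)
  open import Data.List.Relation.Unary.Any using (here; there)
  open import Data.List.Relation.Unary.Unique.Propositional using (Unique)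
  open import Data.Nat using (ℕ)
  open import Data.Product using (_,_)
  open import Data.Rational using (ℚ; 0ℚ; _+_; _*_; _≤_; ∣_∣)
  open import Data.Rational.Properties
    using ( +-identityˡ; +-assoc; *-zeroʳ; *-distribˡ-+; ≤-refl; ≤-trans; +-mono-≤; +-monoʳ-≤
          ; ∣p+q∣≤∣p∣+∣q∣; +-0-commutativeMonoid)
  open import Data.Sum using (inj₁; inj₂)
  open import Function using (_∘_)
  open import Relation.Binary.PropositionalEquality
  open import Algebra.Properties.CommutativeSemigroup (CommutativeMonoid.commutativeSemigroup +-0-commutativeMonoid)
    using (interchange; x∙yz≈y∙xz)
  open import Defs using (Σ)

  Σ-cong : ∀ xs {g h : ℕ → ℚ} → (∀ {x} → x ∈ xs → g x ≡ h x) → Σ xs g ≡ Σ xs h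
  Σ-cong [] _ = refl
  Σ-cong (x ∷ xs) g≗h = cong₂ _+_ (g≗h (here refl)) (Σ-cong xs (g≗h ∘ there))

  Σ-mono-≤ : ∀ xs {g h : ℕ → ℚ} → (∀ {x} → x ∈ xs → g x ≤ h x) → Σ xs g ≤ Σ xs h
  Σ-mono-≤ [] _ = ≤-refl
  Σ-mono-≤ (x ∷ xs) g≤h = +-mono-≤ (g≤h (here refl)) (Σ-mono-≤ xs (g≤h ∘ there))

  Σ-zero : ∀ xs → Σ xs (λ _ → 0ℚ) ≡ 0ℚ
  Σ-zero [] = refl
  Σ-zero (x ∷ xs) = trans (+-identityˡ _) (Σ-zero xs)

  Σ-nonneg : ∀ xs {g : ℕ → ℚ} → (∀ {x} → x ∈ xs → 0ℚ ≤ g x) → 0ℚ ≤ Σ xs g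
  Σ-nonneg xs {g} 0≤g = subst (_≤ Σ xs g) (Σ-zero xs) (Σ-mono-≤ xs 0≤g)

  Σ-++ : ∀ xs ys (g : ℕ → ℚ) → Σ (xs ++ ys) g ≡ Σ xs g + Σ ys g
  Σ-++ [] ys g = sym (+-identityˡ _)
  Σ-++ (x ∷ xs) ys g = trans (cong (g x +_) (Σ-++ xs ys g)) (sym (+-assoc (g x) _ _))

  Σ-map : ∀ xs (k : ℕ → ℕ) (g : ℕ → ℚ) → Σ (map k xs) g ≡ Σ xs (g ∘ k)
  Σ-map [] k g = refl
  Σ-map (x ∷ xs) k g = cong (g (k x) +_) (Σ-map xs k g)

  ∣Σ∣≤Σ∣∣ : ∀ xs (g : ℕ → ℚ) → ∣ Σ xs g ∣ ≤ Σ xs (λ x → ∣ g x ∣)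
  ∣Σ∣≤Σ∣∣ [] g = ≤-refl
  ∣Σ∣≤Σ∣∣ (x ∷ xs) g = ≤-trans (∣p+q∣≤∣p∣+∣q∣ (g x) (Σ xs g)) (+-monoʳ-≤ ∣ g x ∣ (∣Σ∣≤Σ∣∣ xs g))

  *-distribˡ-Σ : ∀ c xs (g : ℕ → ℚ) → c * Σ xs g ≡ Σ xs (λ x → c * g x)
  *-distribˡ-Σ c [] g = *-zeroʳ c
  *-distribˡ-Σ c (x ∷ xs) g = trans (*-distribˡ-+ c (g x) (Σ xs g)) (cong (c * g x +_) (*-distribˡ-Σ c xs g))

  Σ-+ : ∀ xs (g h : ℕ → ℚ) → Σ xs g + Σ xs h ≡ Σ xs (λ x → g x + h x)
  Σ-+ [] g h = +-identityˡ 0ℚ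
  Σ-+ (x ∷ xs) g h = trans (interchange (g x) (Σ xs g) (h x) (Σ xs h)) (cong (g x + h x +_) (Σ-+ xs g h))

  Σ-comm : ∀ xs ys (g : ℕ → ℕ → ℚ) → Σ xs (λ x → Σ ys (g x)) ≡ Σ ys (λ y → Σ xs (λ x → g x y))
  Σ-comm [] ys g = sym (Σ-zero ys)
  Σ-comm (x ∷ xs) ys g = trans (cong (Σ ys (g x) +_) (Σ-comm xs ys g)) (Σ-+ ys (g x) _)

  Σ-filterᵇ : ∀ xs (c : ℕ → Bool) (g : ℕ → ℚ) → Σ xs (λ x → if c x then g x else 0ℚ) ≡ Σ (filterᵇ c xs) g
  Σ-filterᵇ [] c g = refl
  Σ-filterᵇ (x ∷ xs) c g with c x
  ... | true = cong (g x +_) (Σ-filterᵇ xs c g)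
  ... | false = trans (+-identityˡ _) (Σ-filterᵇ xs c g)

  Σ-mono-⊆ : ∀ {xs ys} (h : ℕ → ℚ) → Unique xs → (∀ {x} → x ∈ xs → x ∈ ys) →
    (∀ {y} → y ∈ ys → 0ℚ ≤ h y) → Σ xs h ≤ Σ ys h
  Σ-mono-⊆ {[]} {ys} h _ _ 0≤h = Σ-nonneg ys 0≤h
  Σ-mono-⊆ {x ∷ xs} h (x∉xs ∷ unique) xs⊆ys 0≤h with ∈-∃++ (xs⊆ys (here refl))
  ... | ys₁ , ys₂ , refl =
    subst (h x + Σ xs h ≤_) (sym split) (+-monoʳ-≤ (h x) (Σ-mono-⊆ h unique xs⊆rest 0≤h-rest))
    where
    split : Σ (ys₁ ++ x ∷ ys₂) h ≡ h x + Σ (ys₁ ++ ys₂) h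
    split = trans (Σ-++ ys₁ (x ∷ ys₂) h)
                  (trans (x∙yz≈y∙xz (Σ ys₁ h) (h x) (Σ ys₂ h)) (cong (h x +_) (sym (Σ-++ ys₁ ys₂ h))))
    xs⊆rest : ∀ {z} → z ∈ xs → z ∈ ys₁ ++ ys₂
    xs⊆rest z∈xs with ∈-++⁻ ys₁ (xs⊆ys (there z∈xs))
    ... | inj₁ z∈ys₁ = ∈-++⁺ˡ z∈ys₁
    ... | inj₂ (here refl) = ⊥-elim (lookup x∉xs z∈xs refl)
    ... | inj₂ (there z∈ys₂) = ∈-++⁺ʳ ys₁ z∈ys₂
    0≤h-rest : ∀ {y} → y ∈ ys₁ ++ ys₂ → 0ℚ ≤ h y
    0≤h-rest y∈ with ∈-++⁻ ys₁ y∈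
    ... | inj₁ y∈ys₁ = 0≤h (∈-++⁺ˡ y∈ys₁)
    ... | inj₂ y∈ys₂ = 0≤h (∈-++⁺ʳ ys₁ (there y∈ys₂))

module Rationals where

  open import Data.Bool using (T)
  open import Data.Empty using (⊥-elim)
  open import Data.Integer as ℤ using (ℤ; +_; -[1+_]; +[1+_]; +≤+)
  open import Data.Integer.DivMod using ([n/d]*d≤n)
  import Data.Integer.Properties as ℤ
  open import Data.Nat as ℕ using (ℕ; suc)
  open import Data.Nat.Coprimality as Coprime using (Coprime; 1-coprimeTo)
  import Data.Nat.Properties as ℕ
  open import Data.Rational as ℚ using (ℚ; mkℚ; 0ℚ; 1ℚ; _+_; _*_; _≤_; _<_; ∣_∣; *≤*; *<*)
  open import Data.Rational.Properties
    using (module ≤-Reasoning; _≟_; _≤?_; ≤-reflexive; ≤-trans; ≤-antisym; <-≤-trans; <-irrefl; <⇒≤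
          ; *-comm; *-assoc; *-identityʳ; *-zeroˡ; *-inverseˡ; *-cancelʳ-≤-pos; *-monoˡ-≤-nonNeg; *-monoʳ-≤-nonNeg
          ; nonNegative⁻¹; positive⁻¹; nonNeg*nonNeg⇒nonNeg; pos*pos⇒pos; normalize-coprime
          ; 0≤p⇒∣p∣≡p; ∣p*q∣≡∣p∣*∣q∣; ∣-p∣≡∣p∣)
  open import Relation.Binary.PropositionalEquality
  open import Relation.Nullary using (yes; no)
  open import Relation.Nullary.Decidable using (toWitness; fromWitness)
  open import Defs using (ι; _÷_; bound; _≤ℚ_)

  0≤* : ∀ {a b} → 0ℚ ≤ a → 0ℚ ≤ b → 0ℚ ≤ a * b
  0≤* {a} {b} 0≤a 0≤b = nonNegative⁻¹ _ {{nonNeg*nonNeg⇒nonNeg a {{ℚ.nonNegative 0≤a}} b {{ℚ.nonNegative 0≤b}}}}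

  0<* : ∀ {a b} → 0ℚ < a → 0ℚ < b → 0ℚ < a * b
  0<* {a} {b} 0<a 0<b = positive⁻¹ _ {{pos*pos⇒pos a {{ℚ.positive 0<a}} b {{ℚ.positive 0<b}}}}

  *-monoˡ-≤-0≤ : ∀ {a x y} → 0ℚ ≤ a → x ≤ y → a * x ≤ a * y
  *-monoˡ-≤-0≤ {a} 0≤a = *-monoˡ-≤-nonNeg a {{ℚ.nonNegative 0≤a}}

  ≤ℚ⇒≤ : ∀ {n y} → T (n ≤ℚ y) → ι n ≤ y
  ≤ℚ⇒≤ {n} {y} = toWitness {a? = ι n ≤? y}

  ≤⇒≤ℚ : ∀ {n y} → ι n ≤ y → T (n ≤ℚ y)
  ≤⇒≤ℚ {n} {y} = fromWitness {a? = ι n ≤? y}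

  ι≡mkℚ : ∀ n → ι n ≡ mkℚ (+ n) 0 (Coprime.sym (1-coprimeTo n))
  ι≡mkℚ n = normalize-coprime (Coprime.sym (1-coprimeTo n))

  ι-* : ∀ m n → ι (m ℕ.* n) ≡ ι m * ι n
  ι-* m n rewrite ι≡mkℚ m | ι≡mkℚ n = cong (ℚ._/ 1) (ℤ.pos-* m n)

  ι-+ : ∀ m n → ι (m ℕ.+ n) ≡ ι m + ι n
  ι-+ m n rewrite ι≡mkℚ m | ι≡mkℚ n =
    cong (ℚ._/ 1) (trans (ℤ.pos-+ m n) (sym (cong₂ ℤ._+_ (ℤ.*-identityʳ (+ m)) (ℤ.*-identityʳ (+ n)))))

  ι-mono-≤ : ∀ {m n} → m ℕ.≤ n → ι m ≤ ι n
  ι-mono-≤ {m} {n} m≤n rewrite ι≡mkℚ m | ι≡mkℚ n =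
    *≤* (subst₂ ℤ._≤_ (sym (ℤ.*-identityʳ (+ m))) (sym (ℤ.*-identityʳ (+ n))) (+≤+ m≤n))

  0≤ι : ∀ n → 0ℚ ≤ ι n
  0≤ι n = ι-mono-≤ {0} {n} ℕ.z≤n

  0<ι : ∀ {n} → 1 ℕ.≤ n → 0ℚ < ι n
  0<ι {n} 1≤n = <-≤-trans (*<* (ℤ.+<+ (ℕ.s≤s ℕ.z≤n))) (ι-mono-≤ {1} {n} 1≤n)

  ∣/1∣≡ι∣∣ : ∀ i → ∣ i ℚ./ 1 ∣ ≡ ι ℤ.∣ i ∣
  ∣/1∣≡ι∣∣ (+ n) = trans (cong ∣_∣ (ι≡mkℚ n)) (sym (ι≡mkℚ n))
  ∣/1∣≡ι∣∣ -[1+ n ] = trans (∣-p∣≡∣p∣ (ι (suc n))) (0≤p⇒∣p∣≡p (0≤ι (suc n)))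

  ceiling≡ : ∀ n d .(c : Coprime ℤ.∣ n ∣ (suc d)) → ℚ.ceiling (mkℚ n d c) ≡ ℤ.- ((ℤ.- n) ℤ./ + suc d)
  ceiling≡ (+ 0) d c = refl
  ceiling≡ +[1+ k ] d c = refl
  ceiling≡ -[1+ k ] d c = refl

  ≤-bound : ∀ ℓ y → ι ℓ ≤ y → ℓ ℕ.≤ bound y
  ≤-bound ℓ y@(mkℚ n d _) ℓ≤y = ℕ.≤-trans (ℓ≤∣c∣ ℓ≤c) (ℕ.n≤1+n _)
    where
    D = + suc d
    ℓD≤n : + ℓ ℤ.* D ℤ.≤ n ℤ.* + 1
    ℓD≤n with subst (_≤ y) (ι≡mkℚ ℓ) ℓ≤y
    ... | *≤* ℓD≤n = ℓD≤n
    n≤cD : n ℤ.≤ ℚ.ceiling y ℤ.* D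
    n≤cD = subst₂ ℤ._≤_ (ℤ.neg-involutive n)
                        (trans (ℤ.neg-distribˡ-* ((ℤ.- n) ℤ./ D) D) (cong (ℤ._* D) (sym (ceiling≡ n d _))))
             (ℤ.neg-mono-≤ ([n/d]*d≤n (ℤ.- n) D))
    ℓ≤c : + ℓ ℤ.≤ ℚ.ceiling y
    ℓ≤c = ℤ.*-cancelʳ-≤-pos (+ ℓ) (ℚ.ceiling y) D
            (ℤ.≤-trans ℓD≤n (subst (ℤ._≤ ℚ.ceiling y ℤ.* D) (sym (ℤ.*-identityʳ n)) n≤cD))
    ℓ≤∣c∣ : ∀ {c} → + ℓ ℤ.≤ c → ℓ ℕ.≤ ℤ.∣ c ∣
    ℓ≤∣c∣ (+≤+ ℓ≤c) = ℓ≤c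

  ÷-*-cancel : ∀ x {y} → 0ℚ < y → (x ÷ y) * y ≡ x
  ÷-*-cancel x {y} 0<y with y ≟ 0ℚ
  ... | yes y≡0 = ⊥-elim (<-irrefl (sym y≡0) 0<y)
  ... | no y≢0 = trans (*-assoc x _ y) (trans (cong (x *_) (*-inverseˡ y {{ℚ.≢-nonZero y≢0}})) (*-identityʳ x))

  *≡⇒÷≡ : ∀ {x y r} → 0ℚ < y → r * y ≡ x → x ÷ y ≡ r
  *≡⇒÷≡ {x} {y} {r} 0<y ry≡x = ≤-antisym (cancel (≤-reflexive eq)) (cancel (≤-reflexive (sym eq)))
    where
    eq : (x ÷ y) * y ≡ r * y
    eq = trans (÷-*-cancel x 0<y) (sym ry≡x)
    cancel : ∀ {p q} → p * y ≤ q * y → p ≤ q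
    cancel = *-cancelʳ-≤-pos y {{ℚ.positive 0<y}}

  ÷-mono-≤ : ∀ {x x′ y} → 0ℚ < y → x ≤ x′ → x ÷ y ≤ x′ ÷ y
  ÷-mono-≤ {x} {x′} 0<y x≤x′ = *-cancelʳ-≤-pos _ {{ℚ.positive 0<y}}
    (subst₂ _≤_ (sym (÷-*-cancel x 0<y)) (sym (÷-*-cancel x′ 0<y)) x≤x′)

  ÷-nonneg : ∀ {x y} → 0ℚ < y → 0ℚ ≤ x → 0ℚ ≤ x ÷ y
  ÷-nonneg {x} {y} 0<y 0≤x = subst (_≤ x ÷ y) (*≡⇒÷≡ 0<y (*-zeroˡ y)) (÷-mono-≤ 0<y 0≤x)

  ∣÷∣ : ∀ x {y} → 0ℚ < y → ∣ x ÷ y ∣ ≡ ∣ x ∣ ÷ y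
  ∣÷∣ x {y} 0<y = sym (*≡⇒÷≡ 0<y (begin
    ∣ x ÷ y ∣ * y       ≡⟨ cong (∣ x ÷ y ∣ *_) (sym (0≤p⇒∣p∣≡p (<⇒≤ 0<y))) ⟩
    ∣ x ÷ y ∣ * ∣ y ∣   ≡⟨ sym (∣p*q∣≡∣p∣*∣q∣ (x ÷ y) y) ⟩
    ∣ (x ÷ y) * y ∣     ≡⟨ cong ∣_∣ (÷-*-cancel x 0<y) ⟩
    ∣ x ∣               ∎))
    where open ≡-Reasoning

  ÷-≤ : ∀ {z ℓ} → 0ℚ ≤ z → 1 ℕ.≤ ℓ → z ÷ ι ℓ ≤ z
  ÷-≤ {z} {ℓ} 0≤z 1≤ℓ = subst₂ _≤_ (*-identityʳ (z ÷ ι ℓ)) (÷-*-cancel z 0<ℓ)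
    (*-monoˡ-≤-0≤ (÷-nonneg 0<ℓ 0≤z) (ι-mono-≤ {1} {ℓ} 1≤ℓ))
    where 0<ℓ = 0<ι 1≤ℓ

  ≤÷-swap : ∀ {z a ℓ} → 1 ℕ.≤ a → 1 ℕ.≤ ℓ → ι a ≤ z ÷ ι ℓ → ι ℓ ≤ z ÷ ι a
  ≤÷-swap {z} {a} {ℓ} 1≤a 1≤ℓ a≤z/ℓ = subst (_≤ z ÷ ι a) (*≡⇒÷≡ 0<a refl) (÷-mono-≤ 0<a ℓa≤z)
    where
    0<a = 0<ι 1≤a
    ℓa≤z : ι ℓ * ι a ≤ z
    ℓa≤z = subst₂ _≤_ (*-comm (ι a) (ι ℓ)) (÷-*-cancel z (0<ι 1≤ℓ))
                      (*-monoʳ-≤-nonNeg (ι ℓ) {{ℚ.nonNegative (0≤ι ℓ)}} a≤z/ℓ)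

  *≤⇒≤*1÷ : ∀ {y L c} → 0ℚ < y → y * L ≤ c → L ≤ c * (1ℚ ÷ y)
  *≤⇒≤*1÷ {y} {L} {c} 0<y yL≤c = begin
    L                 ≡⟨ sym (*≡⇒÷≡ 0<y (*-comm L y)) ⟩
    (y * L) ÷ y       ≤⟨ ÷-mono-≤ 0<y yL≤c ⟩
    c ÷ y
      ≡⟨ *≡⇒÷≡ 0<y (trans (*-assoc c _ y) (trans (cong (c *_) (÷-*-cancel 1ℚ 0<y)) (*-identityʳ c))) ⟩
    c * (1ℚ ÷ y)      ∎
    where open ≤-Reasoning

module Mobius where

  open import Algebra.Bundles using (CommutativeMonoid)
  open import Data.Bool using (true; false; T)
  open import Data.Empty using (⊥-elim)
  open import Data.Integer as ℤ using (ℤ; 0ℤ; 1ℤ; -1ℤ)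
  open import Data.List using (length)
  open import Data.Nat as ℕ using (ℕ; zero; suc; _∸_; z≤n; s≤s)
  open import Data.Nat.Divisibility using (_∣_)
  open import Data.Nat.Primality using (Prime)
  open import Data.Rational as ℚ using (ℚ; 0ℚ; 1ℚ; _*_; _≤_; ∣_∣)
  open import Data.Rational.Properties
    using ( module ≤-Reasoning; ≤-refl; ≤-reflexive; <⇒≤; *-identityˡ; *-zeroˡ; *-monoʳ-≤-nonNeg
          ; ∣p*q∣≡∣p∣*∣q∣; 0≤∣p∣; *-1-commutativeMonoid)
  open import Data.Sum using (_⊎_; inj₁; inj₂; [_,_]′)
  open import Function using (_∘_)
  open import Relation.Binary.PropositionalEquality
  open import Relation.Nullary using (¬_)
  open import Algebra.Properties.CommutativeSemigroup (CommutativeMonoid.commutativeSemigroup *-1-commutativeMonoid)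
    using (xy∙z≈y∙xz)
  open import Defs using (μ; μℚ; φ; φ₂; ι; _÷_; squarefree; primeDivisors)
  open Basics
  open Totient
  open TotientTwo
  open SquareFree
  open Rationals

  private
    alternating : {g : ℕ → ℤ} → g 0 ≡ 1ℤ → (∀ k → g (suc k) ≡ ℤ.- g k) → ∀ k → g k ≡ 1ℤ ⊎ g k ≡ -1ℤ
    alternating g0 _ zero = inj₁ g0
    alternating g0 g-suc (suc k) with alternating g0 g-suc k
    ... | inj₁ gk≡1 = inj₂ (trans (g-suc k) (cong ℤ.-_ gk≡1))
    ... | inj₂ gk≡-1 = inj₁ (trans (g-suc k) (cong ℤ.-_ gk≡-1))

  -- The sign function inside Defs.μ is local and cannot be named; unification instantiates `alternating` with it.
  μ-squarefree : ∀ n → T (squarefree n) → μ n ≡ 1ℤ ⊎ μ n ≡ -1ℤ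
  μ-squarefree n t with squarefree n in eq | alternating refl (λ _ → refl) | length (primeDivisors n)
  ... | true | ±1 | k = ±1 k
  ... | false | _ | _ = ⊥-elim (subst T eq t)

  μ-nonsquarefree : ∀ n → ¬ T (squarefree n) → μ n ≡ 0ℤ
  μ-nonsquarefree n ¬t with squarefree n
  ... | true = ⊥-elim (¬t _)
  ... | false = refl

  μℚ²-squarefree : ∀ n → T (squarefree n) → μℚ n * μℚ n ≡ 1ℚ
  μℚ²-squarefree n t with μ-squarefree n t
  ... | inj₁ μ≡1 rewrite μ≡1 = refl
  ... | inj₂ μ≡-1 rewrite μ≡-1 = refl

  μℚ²-nonsquarefree : ∀ n → ¬ T (squarefree n) → μℚ n * μℚ n ≡ 0ℚ
  μℚ²-nonsquarefree n ¬t rewrite μ-nonsquarefree n ¬t = refl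

  ∣μℚ∣≤1 : ∀ n → ∣ μℚ n ∣ ≤ 1ℚ
  ∣μℚ∣≤1 n = T-case (squarefree n) unit vanishing
    where
    unit : T (squarefree n) → ∣ μℚ n ∣ ≤ 1ℚ
    unit t = [ ≤-reflexive ∘ cong (λ m → ∣ m ℚ./ 1 ∣) , ≤-reflexive ∘ cong (λ m → ∣ m ℚ./ 1 ∣) ]′ (μ-squarefree n t)
    vanishing : ¬ T (squarefree n) → ∣ μℚ n ∣ ≤ 1ℚ
    vanishing ¬t = subst (λ m → ∣ m ℚ./ 1 ∣ ≤ 1ℚ) (sym (μ-nonsquarefree n ¬t)) (<⇒≤ (0<ι {1} (s≤s z≤n)))

  -- Opaque: unfolding the Möbius and totient computations during type checking exhausts memory.
  opaque
    μ²/φ : ℕ → ℚ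
    μ²/φ ℓ = (μℚ ℓ * μℚ ℓ) ÷ ι (φ ℓ)

    μ²/φ-def : ∀ ℓ → μ²/φ ℓ ≡ (μℚ ℓ * μℚ ℓ) ÷ ι (φ ℓ)
    μ²/φ-def ℓ = refl

    μ²/φ-1 : μ²/φ 1 ≡ 1ℚ
    μ²/φ-1 = refl

  0≤μ² : ∀ n → 0ℚ ≤ μℚ n * μℚ n
  0≤μ² n = T-case (squarefree n)
    (λ t → subst (0ℚ ≤_) (sym (μℚ²-squarefree n t)) (<⇒≤ (0<ι {1} (s≤s z≤n))))
    (λ ¬t → subst (0ℚ ≤_) (sym (μℚ²-nonsquarefree n ¬t)) ≤-refl)

  0≤μ²/φ : ∀ ℓ → 0ℚ ≤ μ²/φ ℓ
  -- φ 0 = 0, and division by 0ℚ yields 0ℚ.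
  0≤μ²/φ zero = subst (0ℚ ≤_) (sym (μ²/φ-def 0)) ≤-refl
  0≤μ²/φ ℓ@(suc _) = subst (0ℚ ≤_) (sym (μ²/φ-def ℓ)) (÷-nonneg (0<ι (φ-pos {ℓ} (s≤s z≤n))) (0≤μ² ℓ))

  μ²/φ-≤-*prime : ∀ {p ℓ} → Prime p → ¬ p ∣ ℓ → μ²/φ ℓ ≤ ι (p ∸ 1) * μ²/φ (p ℕ.* ℓ)
  μ²/φ-≤-*prime {p@(suc (suc k))} {ℓ} pp p∤ℓ = T-case (squarefree ℓ) squarefree-case nonsquarefree-case
    where
    a = ι (suc k)
    b = ι (φ ℓ)
    0<a = 0<ι {suc k} (s≤s z≤n)
    0<b = 0<ι (φ-pos (∤⇒1≤ p∤ℓ))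

    nonsquarefree-case : ¬ T (squarefree ℓ) → μ²/φ ℓ ≤ a * μ²/φ (p ℕ.* ℓ)
    nonsquarefree-case ¬t = subst (_≤ a * μ²/φ (p ℕ.* ℓ)) (sym μ²/φ≡0) (0≤* (0≤ι (suc k)) (0≤μ²/φ (p ℕ.* ℓ)))
      where
      μ²/φ≡0 : μ²/φ ℓ ≡ 0ℚ
      μ²/φ≡0 = trans (μ²/φ-def ℓ) (trans (cong (_÷ b) (μℚ²-nonsquarefree ℓ ¬t)) (*≡⇒÷≡ 0<b (*-zeroˡ b)))

    squarefree-case : T (squarefree ℓ) → μ²/φ ℓ ≤ a * μ²/φ (p ℕ.* ℓ)
    squarefree-case t = ≤-reflexive (begin
      μ²/φ ℓ                                                  ≡⟨ μ²/φ-def ℓ ⟩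
      (μℚ ℓ * μℚ ℓ) ÷ b                                       ≡⟨ cong (_÷ b) (μℚ²-squarefree ℓ t) ⟩
      1ℚ ÷ b
        ≡⟨ *≡⇒÷≡ 0<b (trans (xy∙z≈y∙xz a (1ℚ ÷ (a * b)) b) (÷-*-cancel 1ℚ (0<* 0<a 0<b))) ⟩
      a * (1ℚ ÷ (a * b))
        ≡⟨ cong₂ (λ x y → a * (x ÷ y)) (sym (μℚ²-squarefree (p ℕ.* ℓ) t-pℓ)) (sym ιφ-pℓ) ⟩
      a * ((μℚ (p ℕ.* ℓ) * μℚ (p ℕ.* ℓ)) ÷ ι (φ (p ℕ.* ℓ)))    ≡⟨ cong (a *_) (sym (μ²/φ-def (p ℕ.* ℓ))) ⟩
      a * μ²/φ (p ℕ.* ℓ)                                      ∎)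
      where
      open ≡-Reasoning
      t-pℓ : T (squarefree (p ℕ.* ℓ))
      t-pℓ = SquareFree⇒squarefree (SquareFree-*prime pp p∤ℓ (squarefree⇒SquareFree (∤⇒1≤ p∤ℓ) t))
      ιφ-pℓ : ι (φ (p ℕ.* ℓ)) ≡ a * b
      ιφ-pℓ = trans (cong ι (φ-*-prime pp p∤ℓ)) (ι-* (suc k) (φ ℓ))

  ∣μφ₂∣≤φ : ∀ {n} → 1 ℕ.≤ n → ∣ μℚ n * (φ₂ n ℚ./ 1) ∣ ≤ ι (φ n)
  ∣μφ₂∣≤φ {n} 1≤n = T-case (squarefree n) squarefree-case nonsquarefree-case
    where
    nonsquarefree-case : ¬ T (squarefree n) → ∣ μℚ n * (φ₂ n ℚ./ 1) ∣ ≤ ι (φ n)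
    nonsquarefree-case ¬t = subst (_≤ ι (φ n)) (sym ∣0∣) (0≤ι (φ n))
      where
      ∣0∣ : ∣ μℚ n * (φ₂ n ℚ./ 1) ∣ ≡ 0ℚ
      ∣0∣ = trans (cong (λ m → ∣ (m ℚ./ 1) * (φ₂ n ℚ./ 1) ∣) (μ-nonsquarefree n ¬t))
                  (cong ∣_∣ (*-zeroˡ (φ₂ n ℚ./ 1)))
    squarefree-case : T (squarefree n) → ∣ μℚ n * (φ₂ n ℚ./ 1) ∣ ≤ ι (φ n)
    squarefree-case t = begin
      ∣ μℚ n * (φ₂ n ℚ./ 1) ∣        ≡⟨ ∣p*q∣≡∣p∣*∣q∣ (μℚ n) _ ⟩
      ∣ μℚ n ∣ * ∣ φ₂ n ℚ./ 1 ∣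
        ≤⟨ *-monoʳ-≤-nonNeg ∣ φ₂ n ℚ./ 1 ∣ {{ℚ.nonNegative (0≤∣p∣ (φ₂ n ℚ./ 1))}} (∣μℚ∣≤1 n) ⟩
      1ℚ * ∣ φ₂ n ℚ./ 1 ∣            ≡⟨ *-identityˡ _ ⟩
      ∣ φ₂ n ℚ./ 1 ∣                 ≡⟨ ∣/1∣≡ι∣∣ (φ₂ n) ⟩
      ι ℤ.∣ φ₂ n ∣                   ≤⟨ ι-mono-≤ (∣φ₂∣≤φ 1≤n (squarefree⇒SquareFree 1≤n t)) ⟩
      ι (φ n)                        ∎
      where open ≤-Reasoning

  ∣μφ₂/φ∣≤1 : ∀ n → ∣ (μℚ n * (φ₂ n ℚ./ 1)) ÷ ι (φ n) ∣ ≤ 1ℚ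
  ∣μφ₂/φ∣≤1 zero = <⇒≤ (0<ι {1} (s≤s z≤n))
  ∣μφ₂/φ∣≤1 n@(suc _) = begin
    ∣ (μℚ n * (φ₂ n ℚ./ 1)) ÷ ι (φ n) ∣    ≡⟨ ∣÷∣ (μℚ n * (φ₂ n ℚ./ 1)) 0<φ ⟩
    ∣ μℚ n * (φ₂ n ℚ./ 1) ∣ ÷ ι (φ n)      ≤⟨ ÷-mono-≤ 0<φ (∣μφ₂∣≤φ {n} (s≤s z≤n)) ⟩
    ι (φ n) ÷ ι (φ n)                      ≡⟨ *≡⇒÷≡ 0<φ (*-identityˡ (ι (φ n))) ⟩
    1ℚ                                     ∎
    where
    open ≤-Reasoning
    0<φ = 0<ι (φ-pos {n} (s≤s z≤n))

module CoprimeSums where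

  open import Algebra.Bundles using (CommutativeMonoid)
  open import Data.Bool using (Bool; _∧_)
  open import Data.Bool.Properties using (T-∧; T?)
  open import Data.List using (List; []; _∷_; _++_; map; filterᵇ)
  open import Data.List.Membership.Propositional using (_∈_)
  open import Data.List.Membership.Propositional.Properties using (∈-filter⁻; ∈-filter⁺; ∈-map⁻; ∈-++⁻)
  open import Data.List.Relation.Unary.All using ([])
  open import Data.List.Relation.Unary.AllPairs using ([]; _∷_)
  open import Data.List.Relation.Unary.Any using (here)
  open import Data.List.Relation.Unary.Unique.Propositional using (Unique)
  import Data.List.Relation.Unary.Unique.Propositional.Properties as Unique
  open import Data.Nat as ℕ using (ℕ; suc; _∸_; z≤n; s≤s)
  open import Data.Nat.Coprimality as Coprime using (Coprime; 1-coprimeTo)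
  open import Data.Nat.Divisibility using (_∣_; m∣m*n; n∣m*n)
  open import Data.Nat.Primality using (Prime; prime⇒nonZero)
  import Data.Nat.Properties as ℕ
  open import Data.Product using (_×_; _,_)
  open import Data.Rational as ℚ using (ℚ; 0ℚ; 1ℚ; _+_; _*_; _≤_; _<_)
  open import Data.Rational.Properties
    using (module ≤-Reasoning; ≤-trans; <-≤-trans; ≤-reflexive; +-identityʳ; +-monoʳ-≤; *-identityˡ; *-assoc; *-comm
          ; *-distribʳ-+; *-distribˡ-+; *-monoʳ-≤-nonNeg; *-1-commutativeMonoid)
  open import Data.Sum using ([_,_])
  open import Function using (_∘_; Equivalence)
  open import Relation.Binary.PropositionalEquality
    using (_≡_; refl; sym; trans; cong; cong₂; subst; module ≡-Reasoning)
  open import Relation.Nullary using (¬_)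
  open import Algebra.Properties.CommutativeSemigroup (CommutativeMonoid.commutativeSemigroup *-1-commutativeMonoid)
    using (x∙yz≈y∙xz)
  open import Defs using (Σ; ι; range; _≤ℚ_; coprimeᵇ; G; P; bound; μℚ; _÷_; φ)
  open Basics
  open Ranges
  open Totient
  open SquareFree
  open ListSums
  open Rationals
  open Mobius

  coprimeSum-terms : ℕ → ℕ → ℚ → List ℕ
  coprimeSum-terms N S Y = filterᵇ (λ ℓ → (ℓ ≤ℚ Y) ∧ coprimeᵇ ℓ S) (range N)

  coprimeSum : ℕ → ℕ → ℚ → ℚ
  coprimeSum N S Y = Σ (coprimeSum-terms N S Y) μ²/φ

  Term : ℕ → ℕ → ℚ → ℕ → Set
  Term N S Y ℓ = 1 ℕ.≤ ℓ × ℓ ℕ.≤ N × ι ℓ ≤ Y × Coprime ℓ S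

  ∈-terms⁻ : ∀ {N S Y ℓ} → ℓ ∈ coprimeSum-terms N S Y → Term N S Y ℓ
  ∈-terms⁻ {N} {S} {Y} {ℓ} ℓ∈ =
    let (ℓ∈N , t) = ∈-filter⁻ (T? ∘ λ ℓ → (ℓ ≤ℚ Y) ∧ coprimeᵇ ℓ S) {xs = range N} ℓ∈
        (1≤ℓ , ℓ≤N) = ∈-range⁻ ℓ∈N
        (ℓ≤Y , ℓ⊥S) = Equivalence.to (T-∧ {ℓ ≤ℚ Y}) t
    in 1≤ℓ , ℓ≤N , ≤ℚ⇒≤ {ℓ} ℓ≤Y , coprimeᵇ⇒Coprime {ℓ} ℓ⊥S

  ∈-terms⁺ : ∀ {N S Y ℓ} → Term N S Y ℓ → ℓ ∈ coprimeSum-terms N S Y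
  ∈-terms⁺ {N} {S} {Y} {ℓ} (1≤ℓ , ℓ≤N , ℓ≤Y , ℓ⊥S) = ∈-filter⁺ (T? ∘ λ ℓ → (ℓ ≤ℚ Y) ∧ coprimeᵇ ℓ S) (∈-range⁺ 1≤ℓ ℓ≤N)
    (Equivalence.from T-∧ (≤⇒≤ℚ {ℓ} ℓ≤Y , Coprime⇒coprimeᵇ ℓ⊥S))

  terms-unique : ∀ N S Y → Unique (coprimeSum-terms N S Y)
  terms-unique N S Y = Unique.filter⁺ _ (range-unique N)

  0≤coprimeSum : ∀ N S Y → 0ℚ ≤ coprimeSum N S Y
  0≤coprimeSum N S Y = Σ-nonneg (coprimeSum-terms N S Y) (λ {ℓ} _ → 0≤μ²/φ ℓ)

  terms-mono : ∀ {N S Y N′ S′ Y′} → (∀ {ℓ} → Term N S Y ℓ → Term N′ S′ Y′ ℓ) →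
    ∀ {ℓ} → ℓ ∈ coprimeSum-terms N S Y → ℓ ∈ coprimeSum-terms N′ S′ Y′
  terms-mono {N} {S} {Y} {N′} {S′} {Y′} implies ℓ∈ = ∈-terms⁺ {N′} {S′} {Y′} (implies (∈-terms⁻ {N} {S} {Y} ℓ∈))

  coprimeSum-mono : ∀ {N S Y N′ S′ Y′} → (∀ {ℓ} → Term N S Y ℓ → Term N′ S′ Y′ ℓ) →
    coprimeSum N S Y ≤ coprimeSum N′ S′ Y′
  coprimeSum-mono {N} {S} {Y} implies =
    Σ-mono-⊆ μ²/φ (terms-unique N S Y) (terms-mono implies) (λ {ℓ} _ → 0≤μ²/φ ℓ)

  0<coprimeSum : ∀ {N} S {Y} → 1 ℕ.≤ N → ι 1 ≤ Y → 0ℚ < coprimeSum N S Y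
  0<coprimeSum {N} S {Y} 1≤N 1≤Y = <-≤-trans (subst (0ℚ <_) (sym Σ[1]) (0<ι {1} (s≤s z≤n)))
    (Σ-mono-⊆ μ²/φ ([] ∷ []) (λ { (here refl) → ∈-terms⁺ (s≤s z≤n , 1≤N , 1≤Y , 1-coprimeTo S) })
                             (λ {ℓ} _ → 0≤μ²/φ ℓ))
    where
    Σ[1] : Σ (1 ∷ []) μ²/φ ≡ 1ℚ
    Σ[1] = trans (+-identityʳ (μ²/φ 1)) μ²/φ-1

  private
    ∈-terms⇒∤ : ∀ {N p S Y ℓ} → Prime p → ℓ ∈ coprimeSum-terms N (p ℕ.* S) Y → ¬ p ∣ ℓ
    ∈-terms⇒∤ {N} {p} {S} {Y} pp ℓ∈ = let (_ , _ , _ , ℓ⊥pS) = ∈-terms⁻ {N} {p ℕ.* S} {Y} ℓ∈ in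
      coprime⇒prime∤ pp (coprime-∣ʳ ℓ⊥pS (m∣m*n S))

    *-∈-terms : ∀ {N p S Y ℓ} → Prime p → Coprime p S →
      ℓ ∈ coprimeSum-terms N (p ℕ.* S) Y → p ℕ.* ℓ ∈ coprimeSum-terms (p ℕ.* N) S (ι p * Y)
    *-∈-terms {N} {p} {S} {Y} {ℓ} pp p⊥S ℓ∈ = conclude (∈-terms⁻ {N} {p ℕ.* S} {Y} ℓ∈)
      where
      instance _ = prime⇒nonZero pp
      conclude : Term N (p ℕ.* S) Y ℓ → p ℕ.* ℓ ∈ coprimeSum-terms (p ℕ.* N) S (ι p * Y)
      conclude (1≤ℓ , ℓ≤N , ℓ≤Y , ℓ⊥pS) = ∈-terms⁺ {p ℕ.* N} {S} {ι p * Y}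
        ( ℕ.≤-trans 1≤ℓ (ℕ.m≤n*m ℓ p) , ℕ.*-monoʳ-≤ p ℓ≤N
        , subst (_≤ ι p * Y) (sym (ι-* p ℓ)) (*-monoˡ-≤-0≤ (0≤ι p) ℓ≤Y)
        , coprime-*ˡ p⊥S (coprime-∣ʳ ℓ⊥pS (n∣m*n p)))

  coprimeSum-with-multiples : ∀ {p S} N Y → Prime p → Coprime p S →
    coprimeSum N (p ℕ.* S) Y + Σ (coprimeSum-terms N (p ℕ.* S) Y) (μ²/φ ∘ (p ℕ.*_))
      ≤ coprimeSum (p ℕ.* N) S (ι p * Y)
  coprimeSum-with-multiples {p} {S} N Y pp p⊥S = subst (_≤ coprimeSum (p ℕ.* N) S (ι p * Y)) Σ-split
    (Σ-mono-⊆ μ²/φ unique ⊆ (λ {ℓ} _ → 0≤μ²/φ ℓ))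
    where
    instance _ = prime⇒nonZero pp
    As = coprimeSum-terms N (p ℕ.* S) Y
    Σ-split : Σ (As ++ map (p ℕ.*_) As) μ²/φ ≡ coprimeSum N (p ℕ.* S) Y + Σ As (μ²/φ ∘ (p ℕ.*_))
    Σ-split = trans (Σ-++ As (map (p ℕ.*_) As) μ²/φ) (cong (coprimeSum N (p ℕ.* S) Y +_) (Σ-map As (p ℕ.*_) μ²/φ))
    disjoint : ∀ {v} → ¬ (v ∈ As × v ∈ map (p ℕ.*_) As)
    disjoint (v∈ , pℓ∈) = let (ℓ , _ , v≡pℓ) = ∈-map⁻ (p ℕ.*_) pℓ∈ in
      ∈-terms⇒∤ {N} {p} {S} {Y} pp v∈ (subst (p ∣_) (sym v≡pℓ) (m∣m*n ℓ))
    unique : Unique (As ++ map (p ℕ.*_) As)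
    unique = Unique.++⁺ (terms-unique N (p ℕ.* S) Y)
                        (Unique.map⁺ (ℕ.*-cancelˡ-≡ _ _ p) (terms-unique N (p ℕ.* S) Y)) disjoint
    1≤ιp : 1ℚ ≤ ι p
    1≤ιp = ι-mono-≤ {1} {p} (ℕ.≤-trans (s≤s z≤n) (prime⇒2≤ pp))
    enlarge : ∀ {ℓ} → Term N (p ℕ.* S) Y ℓ → Term (p ℕ.* N) S (ι p * Y) ℓ
    enlarge {ℓ} (1≤ℓ , ℓ≤N , ℓ≤Y , ℓ⊥pS) = 1≤ℓ , ℕ.≤-trans ℓ≤N (ℕ.m≤n*m N p) , ℓ≤pY , coprime-∣ʳ ℓ⊥pS (n∣m*n p)
      where
      ℓ≤pY : ι ℓ ≤ ι p * Y
      ℓ≤pY = ≤-trans ℓ≤Y (subst (_≤ ι p * Y) (*-identityˡ Y)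
                                (*-monoʳ-≤-nonNeg Y {{ℚ.nonNegative (≤-trans (0≤ι ℓ) ℓ≤Y)}} 1≤ιp))
    ⊆ : ∀ {v} → v ∈ As ++ map (p ℕ.*_) As → v ∈ coprimeSum-terms (p ℕ.* N) S (ι p * Y)
    ⊆ v∈ = [ terms-mono enlarge , ⊆-multiples ] (∈-++⁻ As v∈)
      where
      ⊆-multiples : ∀ {v} → v ∈ map (p ℕ.*_) As → v ∈ coprimeSum-terms (p ℕ.* N) S (ι p * Y)
      ⊆-multiples pℓ∈ = let (ℓ , ℓ∈ , v≡pℓ) = ∈-map⁻ (p ℕ.*_) pℓ∈ in
        subst (_∈ coprimeSum-terms (p ℕ.* N) S (ι p * Y)) (sym v≡pℓ) (*-∈-terms {N} {p} {S} {Y} pp p⊥S ℓ∈)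

  coprimeSum-prime-step : ∀ {p S} N Y → Prime p → Coprime p S →
    ι p * coprimeSum N (p ℕ.* S) Y ≤ ι (p ∸ 1) * coprimeSum (p ℕ.* N) S (ι p * Y)
  coprimeSum-prime-step {p@(suc p′)} {S} N Y pp p⊥S = begin
    ι p * X                      ≡⟨ cong (λ k → ι k * X) (ℕ.+-comm 1 p′) ⟩
    ι (p′ ℕ.+ 1) * X             ≡⟨ cong (_* X) (ι-+ p′ 1) ⟩
    (ι p′ + 1ℚ) * X              ≡⟨ *-distribʳ-+ X (ι p′) 1ℚ ⟩
    ι p′ * X + 1ℚ * X            ≡⟨ cong (ι p′ * X +_) (*-identityˡ X) ⟩
    ι p′ * X + X                 ≤⟨ +-monoʳ-≤ (ι p′ * X) X≤ ⟩
    ι p′ * X + ι p′ * X′         ≡⟨ sym (*-distribˡ-+ (ι p′) X X′) ⟩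
    ι p′ * (X + X′)              ≤⟨ *-monoˡ-≤-0≤ (0≤ι p′) (coprimeSum-with-multiples N Y pp p⊥S) ⟩
    ι p′ * coprimeSum (p ℕ.* N) S (ι p * Y) ∎
    where
    open ≤-Reasoning
    As = coprimeSum-terms N (p ℕ.* S) Y
    X = coprimeSum N (p ℕ.* S) Y
    X′ = Σ As (μ²/φ ∘ (p ℕ.*_))
    X≤ : X ≤ ι p′ * X′
    X≤ = ≤-trans (Σ-mono-≤ As (λ ℓ∈ → μ²/φ-≤-*prime pp (∈-terms⇒∤ {N} {p} {S} {Y} pp ℓ∈)))
                 (≤-reflexive (sym (*-distribˡ-Σ (ι p′) As (μ²/φ ∘ (p ℕ.*_)))))

  coprimeSum-squarefree-step : ∀ {q} → 1 ℕ.≤ q → SquareFree q → ∀ {S} → Coprime q S → ∀ N Y →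
    ι q * coprimeSum N (q ℕ.* S) Y ≤ ι (φ q) * coprimeSum (q ℕ.* N) S (ι q * Y)
  coprimeSum-squarefree-step = SquareFree-induction Step base step
    where
    Step : ℕ → Set
    Step q = ∀ {S} → Coprime q S → ∀ N Y →
      ι q * coprimeSum N (q ℕ.* S) Y ≤ ι (φ q) * coprimeSum (q ℕ.* N) S (ι q * Y)
    base : Step 1
    base {S} _ N Y = ≤-reflexive (begin
      ι 1 * coprimeSum N (1 ℕ.* S) Y          ≡⟨ *-identityˡ _ ⟩
      coprimeSum N (1 ℕ.* S) Y                ≡⟨ cong (λ s → coprimeSum N s Y) (ℕ.*-identityˡ S) ⟩
      coprimeSum N S Y
        ≡⟨ cong₂ (λ n y → coprimeSum n S y) (sym (ℕ.*-identityˡ N)) (sym (*-identityˡ Y)) ⟩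
      coprimeSum (1 ℕ.* N) S (ι 1 * Y)        ≡⟨ sym (*-identityˡ _) ⟩
      ι (φ 1) * coprimeSum (1 ℕ.* N) S (ι 1 * Y) ∎)
      where open ≡-Reasoning
    step : ∀ {p m} → Prime p → ¬ p ∣ m → SquareFree m → Step m → Step (p ℕ.* m)
    step {p} {m} pp p∤m _ induction {S} pm⊥S N Y = begin
      ι (p ℕ.* m) * coprimeSum N (p ℕ.* m ℕ.* S) Y
        ≡⟨ cong₂ _*_ (ι-* p m)
                     (cong (λ s → coprimeSum N s Y) (trans (cong (ℕ._* S) (ℕ.*-comm p m)) (ℕ.*-assoc m p S))) ⟩
      ι p * ι m * coprimeSum N (m ℕ.* (p ℕ.* S)) Y
        ≡⟨ *-assoc (ι p) (ι m) _ ⟩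
      ι p * (ι m * coprimeSum N (m ℕ.* (p ℕ.* S)) Y)
        ≤⟨ *-monoˡ-≤-0≤ (0≤ι p) (induction m⊥pS N Y) ⟩
      ι p * (ι (φ m) * coprimeSum (m ℕ.* N) (p ℕ.* S) (ι m * Y))
        ≡⟨ x∙yz≈y∙xz (ι p) (ι (φ m)) _ ⟩
      ι (φ m) * (ι p * coprimeSum (m ℕ.* N) (p ℕ.* S) (ι m * Y))
        ≤⟨ *-monoˡ-≤-0≤ (0≤ι (φ m)) (coprimeSum-prime-step (m ℕ.* N) (ι m * Y) pp p⊥S) ⟩
      ι (φ m) * (ι (p ∸ 1) * coprimeSum (p ℕ.* (m ℕ.* N)) S (ι p * (ι m * Y)))
        ≡⟨ sym (*-assoc (ι (φ m)) (ι (p ∸ 1)) _) ⟩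
      ι (φ m) * ι (p ∸ 1) * coprimeSum (p ℕ.* (m ℕ.* N)) S (ι p * (ι m * Y))
        ≡⟨ cong₂ _*_ ιφ-pm (cong₂ (λ n y → coprimeSum n S y) (sym (ℕ.*-assoc p m N)) ιpm*Y) ⟩
      ι (φ (p ℕ.* m)) * coprimeSum (p ℕ.* m ℕ.* N) S (ι (p ℕ.* m) * Y) ∎
      where
      open ≤-Reasoning
      p⊥S = coprime-∣ˡ pm⊥S (m∣m*n m)
      m⊥pS = coprime-*ʳ (Coprime.sym (prime∤⇒coprime pp p∤m)) (coprime-∣ˡ pm⊥S (n∣m*n p))
      ιφ-pm : ι (φ m) * ι (p ∸ 1) ≡ ι (φ (p ℕ.* m))
      ιφ-pm = trans (*-comm (ι (φ m)) _) (trans (sym (ι-* (p ∸ 1) (φ m))) (cong ι (sym (φ-*-prime pp p∤m))))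
      ιpm*Y : ι p * (ι m * Y) ≡ ι (p ℕ.* m) * Y
      ιpm*Y = trans (sym (*-assoc (ι p) (ι m) Y)) (cong (_* Y) (sym (ι-* p m)))

  G≡coprimeSum : ∀ d y z₀ → G d y z₀ ≡ coprimeSum (bound y) (d ℕ.* P z₀) y
  G≡coprimeSum d y z₀ =
    Σ-cong (coprimeSum-terms (bound y) (d ℕ.* P z₀) y) {λ ℓ → (μℚ ℓ * μℚ ℓ) ÷ ι (φ ℓ)} {μ²/φ}
      (λ {ℓ} _ → sym (μ²/φ-def ℓ))

  0≤G : ∀ d y z₀ → 0ℚ ≤ G d y z₀
  0≤G d y z₀ = subst (0ℚ ≤_) (sym (G≡coprimeSum d y z₀)) (0≤coprimeSum (bound y) (d ℕ.* P z₀) y)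

  0<G : ∀ d {y} z₀ → ι 1 ≤ y → 0ℚ < G d y z₀
  0<G d {y} z₀ 1≤y = subst (0ℚ <_) (sym (G≡coprimeSum d y z₀)) (0<coprimeSum (d ℕ.* P z₀) (s≤s z≤n) 1≤y)

module TripleSums where

  open import Data.Bool using (Bool; true; false; T; _∧_; if_then_else_)
  open import Data.Bool.Properties using (T-∧)
  open import Data.Empty using (⊥-elim)
  open import Data.List using (List)
  open import Data.Nat as ℕ using (ℕ; _≡ᵇ_)
  import Data.Nat.Properties as ℕ
  open import Data.Product using (_,_)
  open import Data.Rational using (ℚ; 0ℚ; _*_; _≤_; ∣_∣)
  open import Data.Rational.Properties using (≤-refl; ≤-trans; ≤-reflexive; *-zeroʳ; *-zeroˡ)
  open import Function using (Equivalence)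
  open import Relation.Binary.PropositionalEquality using (_≡_; refl; sym; trans; subst)
  open import Defs using (Σ; Σ₃; range)
  open ListSums

  private
    Σ³ : List ℕ → (ℕ → ℕ → ℕ → ℚ) → ℚ
    Σ³ R g = Σ R λ a → Σ R λ b → Σ R λ d → g a b d

    counted : ℕ → (ℕ → ℕ → ℕ → Bool) → ℕ → ℕ → ℕ → Bool
    counted q c a b d = (a ℕ.* b ℕ.* d ≡ᵇ q) ∧ c a b d

    restrict : ℕ → (ℕ → ℕ → ℕ → Bool) → (ℕ → ℕ → ℕ → ℚ) → ℕ → ℕ → ℕ → ℚ
    restrict q c f a b d = if counted q c a b d then f a b d else 0ℚ

    Σ³-cong : ∀ R {g h : ℕ → ℕ → ℕ → ℚ} → (∀ a b d → g a b d ≡ h a b d) → Σ³ R g ≡ Σ³ R h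
    Σ³-cong R g≗h = Σ-cong R λ {a} _ → Σ-cong R λ {b} _ → Σ-cong R λ {d} _ → g≗h a b d

    Σ³-mono-≤ : ∀ R {g h : ℕ → ℕ → ℕ → ℚ} → (∀ a b d → g a b d ≤ h a b d) → Σ³ R g ≤ Σ³ R h
    Σ³-mono-≤ R g≤h = Σ-mono-≤ R λ {a} _ → Σ-mono-≤ R λ {b} _ → Σ-mono-≤ R λ {d} _ → g≤h a b d

    ∣Σ³∣≤Σ³∣∣ : ∀ R (g : ℕ → ℕ → ℕ → ℚ) → ∣ Σ³ R g ∣ ≤ Σ³ R (λ a b d → ∣ g a b d ∣)
    ∣Σ³∣≤Σ³∣∣ R g =
      ≤-trans (∣Σ∣≤Σ∣∣ R λ a → Σ R λ b → Σ R (g a b)) (Σ-mono-≤ R λ {a} _ →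
      ≤-trans (∣Σ∣≤Σ∣∣ R λ b → Σ R (g a b)) (Σ-mono-≤ R λ {b} _ →
      ∣Σ∣≤Σ∣∣ R (g a b)))

    *-distribˡ-Σ³ : ∀ k R (g : ℕ → ℕ → ℕ → ℚ) → k * Σ³ R g ≡ Σ³ R (λ a b d → k * g a b d)
    *-distribˡ-Σ³ k R g =
      trans (*-distribˡ-Σ k R λ a → Σ R λ b → Σ R (g a b)) (Σ-cong R λ {a} _ →
      trans (*-distribˡ-Σ k R λ b → Σ R (g a b)) (Σ-cong R λ {b} _ →
      *-distribˡ-Σ k R (g a b)))

    Σ-Σ³-comm : ∀ xs R (g : ℕ → ℕ → ℕ → ℕ → ℚ) →
      Σ xs (λ ℓ → Σ³ R (g ℓ)) ≡ Σ³ R (λ a b d → Σ xs (λ ℓ → g ℓ a b d))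
    Σ-Σ³-comm xs R g =
      trans (Σ-comm xs R λ ℓ a → Σ R λ b → Σ R (g ℓ a b)) (Σ-cong R λ {a} _ →
      trans (Σ-comm xs R λ ℓ b → Σ R (g ℓ a b)) (Σ-cong R λ {b} _ →
      Σ-comm xs R (λ ℓ → g ℓ a b)))

    ∣if∣ : ∀ b (x : ℚ) → ∣ (if b then x else 0ℚ) ∣ ≡ (if b then ∣ x ∣ else 0ℚ)
    ∣if∣ true x = refl
    ∣if∣ false x = refl

    *-if : ∀ k b (x : ℚ) → k * (if b then x else 0ℚ) ≡ (if b then k * x else 0ℚ)
    *-if k true x = refl
    *-if k false x = *-zeroʳ k

    Σ-if : ∀ xs b (f : ℕ → ℚ) → Σ xs (λ ℓ → if b then f ℓ else 0ℚ) ≡ (if b then Σ xs f else 0ℚ)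
    Σ-if xs true f = refl
    Σ-if xs false f = Σ-zero xs

    if-mono-≤ : ∀ b {x y : ℚ} → (T b → x ≤ y) → (if b then x else 0ℚ) ≤ (if b then y else 0ℚ)
    if-mono-≤ true x≤y = x≤y _
    if-mono-≤ false _ = ≤-refl

  ∣Σ₃∣≤Σ₃∣∣ : ∀ q c f → ∣ Σ₃ q c f ∣ ≤ Σ₃ q c (λ a b d → ∣ f a b d ∣)
  ∣Σ₃∣≤Σ₃∣∣ q c f = ≤-trans (∣Σ³∣≤Σ³∣∣ (range q) (restrict q c f))
    (≤-reflexive (Σ³-cong (range q) λ a b d → ∣if∣ (counted q c a b d) (f a b d)))

  Σ₃-mono-≤ : ∀ q c {f g} → (∀ a b d → a ℕ.* b ℕ.* d ≡ q → T (c a b d) → f a b d ≤ g a b d) →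
    Σ₃ q c f ≤ Σ₃ q c g
  Σ₃-mono-≤ q c f≤g = Σ³-mono-≤ (range q) λ a b d → if-mono-≤ (counted q c a b d) λ t →
    let (abd≡q , c-holds) = Equivalence.to (T-∧ {a ℕ.* b ℕ.* d ≡ᵇ q}) t in
    f≤g a b d (ℕ.≡ᵇ⇒≡ (a ℕ.* b ℕ.* d) q abd≡q) c-holds

  *-distribˡ-Σ₃ : ∀ k q c f → k * Σ₃ q c f ≡ Σ₃ q c (λ a b d → k * f a b d)
  *-distribˡ-Σ₃ k q c f = trans (*-distribˡ-Σ³ k (range q) (restrict q c f))
    (Σ³-cong (range q) λ a b d → *-if k (counted q c a b d) (f a b d))

  Σ-Σ₃-comm : ∀ xs q c (f : ℕ → ℕ → ℕ → ℕ → ℚ) →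
    Σ xs (λ ℓ → Σ₃ q c (f ℓ)) ≡ Σ₃ q c (λ a b d → Σ xs (λ ℓ → f ℓ a b d))
  Σ-Σ₃-comm xs q c f = trans (Σ-Σ³-comm xs (range q) (λ ℓ → restrict q c (f ℓ)))
    (Σ³-cong (range q) λ a b d → Σ-if xs (counted q c a b d) (λ ℓ → f ℓ a b d))

  Σ₃-restrict : ∀ q {c c′} f → (∀ a b d → T (c a b d) → T (c′ a b d)) →
    Σ₃ q c f ≡ Σ₃ q c′ (λ a b d → if c a b d then f a b d else 0ℚ)
  Σ₃-restrict q {c} {c′} f c⇒c′ =
    Σ³-cong (range q) λ a b d → pointwise (a ℕ.* b ℕ.* d ≡ᵇ q) (c a b d) (c′ a b d) (c⇒c′ a b d)
    where
    pointwise : ∀ e x x′ {v : ℚ} → (T x → T x′) →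
      (if e ∧ x then v else 0ℚ) ≡ (if e ∧ x′ then (if x then v else 0ℚ) else 0ℚ)
    pointwise false _ _ _ = refl
    pointwise true true true _ = refl
    pointwise true true false x⇒x′ = ⊥-elim (x⇒x′ _)
    pointwise true false true _ = refl
    pointwise true false false _ = refl

  0≤Σ₃ : ∀ q c {f} → (∀ a b d → a ℕ.* b ℕ.* d ≡ q → T (c a b d) → 0ℚ ≤ f a b d) → 0ℚ ≤ Σ₃ q c f
  0≤Σ₃ q c {f} 0≤f = subst (_≤ Σ₃ q c f) (trans (sym (*-distribˡ-Σ₃ 0ℚ q c f)) (*-zeroˡ (Σ₃ q c f)))
    (Σ₃-mono-≤ q c λ a b d abd≡q t → subst (_≤ f a b d) (sym (*-zeroˡ (f a b d))) (0≤f a b d abd≡q t))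

open import Defs
open import Data.Nat as ℕ using (ℕ; NonZero)
open import Data.Bool using (_∧_)
open import Data.Nat.Coprimality using (Coprime)
open import Data.Rational using (ℚ; 1ℚ; _≤_; _*_; ∣_∣)

open import Data.Bool using (Bool; T; if_then_else_)
open import Data.Bool.Properties using (T-∧; T?)
open import Data.List using (List; filterᵇ)
open import Data.List.Membership.Propositional using (_∈_)
open import Data.List.Membership.Propositional.Properties using (∈-filter⁻)
open import Data.List.Relation.Unary.Unique.Propositional using (Unique)
import Data.List.Relation.Unary.Unique.Propositional.Properties as Unique
import Data.Nat.Properties as ℕ
open import Data.Product using (_×_; _,_; proj₁; proj₂)
open import Data.Rational as ℚ using (0ℚ; _<_)
open import Data.Rational.Properties
  using ( module ≤-Reasoning; ≤-trans; ≤-reflexive; *-comm; *-assoc; *-identityˡ; *-identityʳ; *-zeroˡ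
        ; *-monoʳ-≤-nonNeg; 0≤∣p∣; ∣p*q∣≡∣p∣*∣q∣; 0≤p⇒∣p∣≡p)
open import Function using (_∘_; Equivalence)
open import Relation.Binary.PropositionalEquality using (_≡_; sym; trans; cong; subst)
open import Relation.Nullary using (¬_)
open Basics
open Ranges
open SquareFree
open Totient
open ListSums
open Rationals
open Mobius
open CoprimeSums
open TripleSums

below : ℚ → ℕ → ℕ → ℕ → Bool
below y q₁ q₂ q₃ = ((q₁ ℕ.* q₃) ≤ℚ y) ∧ ((q₂ ℕ.* q₃) ≤ℚ y)

∣ξ∣≤Σ₃1 : ∀ q y → ∣ ξ q y ∣ ≤ Σ₃ q (below y) (λ _ _ _ → 1ℚ)
∣ξ∣≤Σ₃1 q y = ≤-trans (∣Σ₃∣≤Σ₃∣∣ q (below y) coefficient) (Σ₃-mono-≤ q (below y) λ _ _ q₃ _ _ → ∣μφ₂/φ∣≤1 q₃)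
  where
  coefficient : ℕ → ℕ → ℕ → ℚ
  coefficient _ _ q₃ = (μℚ q₃ * (φ₂ q₃ ℚ./ 1)) ÷ ι (φ q₃)

below-÷ : ∀ {z ℓ} a b d → 0ℚ ≤ z → 1 ℕ.≤ ℓ → T (below (z ÷ ι ℓ) a b d) → T (below z a b d)
below-÷ {z} {ℓ} a b d 0≤z 1≤ℓ t =
  let (ad≤ , bd≤) = Equivalence.to (T-∧ {(a ℕ.* d) ≤ℚ (z ÷ ι ℓ)}) t in Equivalence.from T-∧
    ( ≤⇒≤ℚ {a ℕ.* d} (≤-trans (≤ℚ⇒≤ {a ℕ.* d} ad≤) (÷-≤ 0≤z 1≤ℓ))
    , ≤⇒≤ℚ {b ℕ.* d} (≤-trans (≤ℚ⇒≤ {b ℕ.* d} bd≤) (÷-≤ 0≤z 1≤ℓ)))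

module GqBound (z₀ z : ℚ) (τ q : ℕ) (1≤z : ι 1 ≤ z) (1≤q : 1 ℕ.≤ q) (sf : SquareFree q)
                (q⊥S : Coprime q (τ ℕ.* P z₀)) where

  S : ℕ
  S = τ ℕ.* P z₀

  Gz² : ℚ
  Gz² = G τ (z * z) z₀

  ℓ-condition : ℕ → Bool
  ℓ-condition ℓ = ((ℓ ℕ.* ℓ ℕ.* q) ≤ℚ (z * z)) ∧ coprimeᵇ ℓ (q ℕ.* τ ℕ.* P z₀)

  ℓ-terms : List ℕ
  ℓ-terms = filterᵇ ℓ-condition (range (bound z))

  0≤z : 0ℚ ≤ z
  0≤z = ≤-trans (0≤ι 1) 1≤z

  ∈ℓ-terms⁻ : ∀ {ℓ} → ℓ ∈ ℓ-terms → 1 ℕ.≤ ℓ × ℓ ℕ.≤ bound z × Coprime ℓ (q ℕ.* S)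
  ∈ℓ-terms⁻ {ℓ} ℓ∈ = from-filter (∈-filter⁻ (T? ∘ ℓ-condition) {xs = range (bound z)} ℓ∈)
    where
    from-filter : ℓ ∈ range (bound z) × T (ℓ-condition ℓ) → 1 ℕ.≤ ℓ × ℓ ℕ.≤ bound z × Coprime ℓ (q ℕ.* S)
    from-filter (ℓ∈range , t) =
      let (1≤ℓ , ℓ≤) = ∈-range⁻ ℓ∈range
          (_ , ℓ⊥qS) = Equivalence.to (T-∧ {(ℓ ℕ.* ℓ ℕ.* q) ≤ℚ (z * z)}) t
      in 1≤ℓ , ℓ≤ , subst (Coprime ℓ) (ℕ.*-assoc q τ (P z₀)) (coprimeᵇ⇒Coprime {ℓ} ℓ⊥qS)

  triple-bound : ∀ a b d → a ℕ.* b ℕ.* d ≡ q → T (below z a b d) →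
    ι q * Σ ℓ-terms (λ ℓ → if below (z ÷ ι ℓ) a b d then μ²/φ ℓ else 0ℚ) ≤ ι (φ q) * Gz²
  triple-bound a b d abd≡q t = begin
    ι q * Σ ℓ-terms (λ ℓ → if below (z ÷ ι ℓ) a b d then μ²/φ ℓ else 0ℚ)
      ≡⟨ cong (ι q *_) (Σ-filterᵇ ℓ-terms (λ ℓ → below (z ÷ ι ℓ) a b d) μ²/φ) ⟩
    ι q * Σ near μ²/φ
      ≤⟨ *-monoˡ-≤-0≤ (0≤ι q) (Σ-mono-⊆ μ²/φ near-unique near⊆ (λ {ℓ} _ → 0≤μ²/φ ℓ)) ⟩
    ι q * coprimeSum (bound z) (q ℕ.* S) Y
      ≤⟨ coprimeSum-squarefree-step 1≤q sf q⊥S (bound z) Y ⟩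
    ι (φ q) * coprimeSum (q ℕ.* bound z) S (ι q * Y)
      ≤⟨ *-monoˡ-≤-0≤ (0≤ι (φ q)) (subst (coprimeSum (q ℕ.* bound z) S (ι q * Y) ≤_)
                                          (sym (G≡coprimeSum τ (z * z) z₀)) (coprimeSum-mono within-z²)) ⟩
    ι (φ q) * Gz² ∎
    where
    open ≤-Reasoning
    near : List ℕ
    near = filterᵇ (λ ℓ → below (z ÷ ι ℓ) a b d) ℓ-terms
    Y : ℚ
    Y = z ÷ ι (b ℕ.* d)
    nonZero-a[bd] : NonZero (a ℕ.* (b ℕ.* d))
    nonZero-a[bd] = subst NonZero (trans (sym abd≡q) (ℕ.*-assoc a b d)) (ℕ.>-nonZero 1≤q)
    1≤bd : 1 ℕ.≤ b ℕ.* d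
    1≤bd = ℕ.>-nonZero⁻¹ (b ℕ.* d) {{ℕ.m*n≢0⇒n≢0 a {{nonZero-a[bd]}}}}
    ad≤z : ι (a ℕ.* d) ≤ z
    ad≤z = ≤ℚ⇒≤ {a ℕ.* d} (proj₁ (Equivalence.to (T-∧ {(a ℕ.* d) ≤ℚ z}) t))
    a≤z : ι a ≤ z
    a≤z = ≤-trans (ι-mono-≤ (ℕ.m≤m*n a d {{ℕ.m*n≢0⇒n≢0 b {{ℕ.m*n≢0⇒n≢0 a {{nonZero-a[bd]}}}}}})) ad≤z
    qY≡az : ι q * Y ≡ ι a * z
    qY≡az = begin-equality
      ι q * Y                        ≡⟨ cong (λ n → ι n * Y) (trans (sym abd≡q) (ℕ.*-assoc a b d)) ⟩
      ι (a ℕ.* (b ℕ.* d)) * Y        ≡⟨ cong (_* Y) (ι-* a (b ℕ.* d)) ⟩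
      ι a * ι (b ℕ.* d) * Y          ≡⟨ *-assoc (ι a) _ Y ⟩
      ι a * (ι (b ℕ.* d) * Y)
        ≡⟨ cong (ι a *_) (trans (*-comm (ι (b ℕ.* d)) Y) (÷-*-cancel z (0<ι 1≤bd))) ⟩
      ι a * z                        ∎
    qY≤z² : ι q * Y ≤ z * z
    qY≤z² = subst (_≤ z * z) (sym qY≡az) (*-monoʳ-≤-nonNeg z {{ℚ.nonNegative 0≤z}} a≤z)
    near-unique : Unique near
    near-unique = Unique.filter⁺ (T? ∘ λ ℓ → below (z ÷ ι ℓ) a b d)
                                 (Unique.filter⁺ (T? ∘ ℓ-condition) (range-unique (bound z)))
    near⊆ : ∀ {ℓ} → ℓ ∈ near → ℓ ∈ coprimeSum-terms (bound z) (q ℕ.* S) Y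
    near⊆ {ℓ} ℓ∈ = from-filter (∈-filter⁻ (T? ∘ λ ℓ → below (z ÷ ι ℓ) a b d) {xs = ℓ-terms} ℓ∈)
      where
      from-filter : ℓ ∈ ℓ-terms × T (below (z ÷ ι ℓ) a b d) → ℓ ∈ coprimeSum-terms (bound z) (q ℕ.* S) Y
      from-filter (ℓ∈ℓ-terms , t′) =
        let (1≤ℓ , ℓ≤ , ℓ⊥qS) = ∈ℓ-terms⁻ ℓ∈ℓ-terms
            bd≤z/ℓ = ≤ℚ⇒≤ {b ℕ.* d} (proj₂ (Equivalence.to (T-∧ {(a ℕ.* d) ≤ℚ (z ÷ ι ℓ)}) t′))
        in ∈-terms⁺ {bound z} {q ℕ.* S} {Y} (1≤ℓ , ℓ≤ , ≤÷-swap 1≤bd 1≤ℓ bd≤z/ℓ , ℓ⊥qS)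
    within-z² : ∀ {ℓ} → Term (q ℕ.* bound z) S (ι q * Y) ℓ → Term (bound (z * z)) S (z * z) ℓ
    within-z² {ℓ} (1≤ℓ , _ , ℓ≤qY , ℓ⊥S) = 1≤ℓ , ≤-bound ℓ (z * z) ℓ≤z² , ℓ≤z² , ℓ⊥S
      where ℓ≤z² = ≤-trans ℓ≤qY qY≤z²

  μ²/φ-if-below : ℕ → ℕ → ℕ → ℕ → ℚ
  μ²/φ-if-below ℓ a b d = if below (z ÷ ι ℓ) a b d then μ²/φ ℓ else 0ℚ

  ℓ-term-bound : ∀ {ℓ} → 1 ℕ.≤ ℓ → ∣ ((μℚ ℓ * μℚ ℓ) ÷ ι (φ ℓ)) * ξ q (z ÷ ι ℓ) ∣ ≤ Σ₃ q (below z) (μ²/φ-if-below ℓ)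
  ℓ-term-bound {ℓ} 1≤ℓ = begin
    ∣ ((μℚ ℓ * μℚ ℓ) ÷ ι (φ ℓ)) * ξ q (z ÷ ι ℓ) ∣   ≡⟨ cong (λ x → ∣ x * ξ q (z ÷ ι ℓ) ∣) (sym (μ²/φ-def ℓ)) ⟩
    ∣ μ²/φ ℓ * ξ q (z ÷ ι ℓ) ∣                     ≡⟨ ∣p*q∣≡∣p∣*∣q∣ (μ²/φ ℓ) (ξ q (z ÷ ι ℓ)) ⟩
    ∣ μ²/φ ℓ ∣ * ∣ ξ q (z ÷ ι ℓ) ∣                 ≡⟨ cong (_* ∣ ξ q (z ÷ ι ℓ) ∣) (0≤p⇒∣p∣≡p (0≤μ²/φ ℓ)) ⟩
    μ²/φ ℓ * ∣ ξ q (z ÷ ι ℓ) ∣                     ≤⟨ *-monoˡ-≤-0≤ (0≤μ²/φ ℓ) (∣ξ∣≤Σ₃1 q (z ÷ ι ℓ)) ⟩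
    μ²/φ ℓ * Σ₃ q (below (z ÷ ι ℓ)) (λ _ _ _ → 1ℚ)
      ≡⟨ *-distribˡ-Σ₃ (μ²/φ ℓ) q (below (z ÷ ι ℓ)) (λ _ _ _ → 1ℚ) ⟩
    Σ₃ q (below (z ÷ ι ℓ)) (λ _ _ _ → μ²/φ ℓ * 1ℚ)
      ≤⟨ Σ₃-mono-≤ q (below (z ÷ ι ℓ)) (λ _ _ _ _ _ → ≤-reflexive (*-identityʳ (μ²/φ ℓ))) ⟩
    Σ₃ q (below (z ÷ ι ℓ)) (λ _ _ _ → μ²/φ ℓ)
      ≡⟨ Σ₃-restrict q {below (z ÷ ι ℓ)} {below z} (λ _ _ _ → μ²/φ ℓ) (λ a b d → below-÷ a b d 0≤z 1≤ℓ) ⟩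
    Σ₃ q (below z) (μ²/φ-if-below ℓ)                   ∎
    where open ≤-Reasoning

  ∣G[q]∣≤ : ∣ G[ q ] z z₀ τ ∣ ≤ ι (φ q) * Gz² * Σ₃ q (below z) (λ a b d → 1ℚ ÷ ι (a ℕ.* b ℕ.* d))
  ∣G[q]∣≤ = begin
    ∣ G[ q ] z z₀ τ ∣                                                   ≤⟨ ∣Σ∣≤Σ∣∣ ℓ-terms term ⟩
    Σ ℓ-terms (λ ℓ → ∣ term ℓ ∣)
      ≤⟨ Σ-mono-≤ ℓ-terms (λ ℓ∈ → ℓ-term-bound (proj₁ (∈ℓ-terms⁻ ℓ∈))) ⟩
    Σ ℓ-terms (λ ℓ → Σ₃ q (below z) (μ²/φ-if-below ℓ))
      ≡⟨ Σ-Σ₃-comm ℓ-terms q (below z) μ²/φ-if-below ⟩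
    Σ₃ q (below z) (λ a b d → Σ ℓ-terms (λ ℓ → μ²/φ-if-below ℓ a b d))      ≤⟨ Σ₃-mono-≤ q (below z) triple ⟩
    Σ₃ q (below z) (λ a b d → ι (φ q) * Gz² * (1ℚ ÷ ι (a ℕ.* b ℕ.* d)))
      ≡⟨ sym (*-distribˡ-Σ₃ (ι (φ q) * Gz²) q (below z) (λ a b d → 1ℚ ÷ ι (a ℕ.* b ℕ.* d))) ⟩
    ι (φ q) * Gz² * Σ₃ q (below z) (λ a b d → 1ℚ ÷ ι (a ℕ.* b ℕ.* d))     ∎
    where
    open ≤-Reasoning
    term : ℕ → ℚ
    term ℓ = ((μℚ ℓ * μℚ ℓ) ÷ ι (φ ℓ)) * ξ q (z ÷ ι ℓ)
    triple : ∀ a b d → a ℕ.* b ℕ.* d ≡ q → T (below z a b d) →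
      Σ ℓ-terms (λ ℓ → μ²/φ-if-below ℓ a b d) ≤ ι (φ q) * Gz² * (1ℚ ÷ ι (a ℕ.* b ℕ.* d))
    triple a b d abd≡q t =
      subst (λ n → Σ ℓ-terms (λ ℓ → μ²/φ-if-below ℓ a b d) ≤ ι (φ q) * Gz² * (1ℚ ÷ ι n)) (sym abd≡q)
      (*≤⇒≤*1÷ (0<ι 1≤q) (triple-bound a b d abd≡q t))

0≤Σ₃-reciprocals : ∀ {q c} → 1 ℕ.≤ q → 0ℚ ≤ Σ₃ q c (λ a b d → 1ℚ ÷ ι (a ℕ.* b ℕ.* d))
0≤Σ₃-reciprocals {q} {c} 1≤q = 0≤Σ₃ q c λ a b d abd≡q _ → ÷-nonneg (0<ι (subst (1 ℕ.≤_) (sym abd≡q) 1≤q)) (0≤ι 1)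

w-selected : ∀ q z z₀ τ → T (squarefree q ∧ coprimeᵇ q (τ ℕ.* P z₀)) →
  w q z z₀ τ ≡ (μℚ q ÷ (ι (φ q) * G τ z z₀)) * (G[ q ] z z₀ τ ÷ G τ z z₀)
w-selected q z z₀ τ = if-T (squarefree q ∧ coprimeᵇ q (τ ℕ.* P z₀))

w-discarded : ∀ q z z₀ τ → ¬ T (squarefree q ∧ coprimeᵇ q (τ ℕ.* P z₀)) → w q z z₀ τ ≡ 0ℚ
w-discarded q z z₀ τ = if-¬T (squarefree q ∧ coprimeᵇ q (τ ℕ.* P z₀))

quotient-bound : ∀ {u a A g G₂ S₃} → ∣ u ∣ ≤ 1ℚ → 0ℚ < a → 0ℚ < A → ∣ g ∣ ≤ a * G₂ * S₃ →
  ∣ (u ÷ (a * A)) * (g ÷ A) * A ∣ ≤ (G₂ ÷ A) * S₃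
quotient-bound {u} {a} {A} {g} {G₂} {S₃} ∣u∣≤1 0<a 0<A ∣g∣≤ = begin
  ∣ (u ÷ (a * A)) * (g ÷ A) * A ∣
    ≡⟨ cong ∣_∣ (trans (*-assoc (u ÷ (a * A)) (g ÷ A) A) (cong ((u ÷ (a * A)) *_) (÷-*-cancel g 0<A))) ⟩
  ∣ (u ÷ (a * A)) * g ∣                 ≡⟨ ∣p*q∣≡∣p∣*∣q∣ (u ÷ (a * A)) g ⟩
  ∣ u ÷ (a * A) ∣ * ∣ g ∣               ≡⟨ cong (_* ∣ g ∣) (∣÷∣ u 0<aA) ⟩
  (∣ u ∣ ÷ (a * A)) * ∣ g ∣
    ≤⟨ *-monoʳ-≤-nonNeg ∣ g ∣ {{ℚ.nonNegative (0≤∣p∣ g)}} (÷-mono-≤ 0<aA ∣u∣≤1) ⟩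
  (1ℚ ÷ (a * A)) * ∣ g ∣                ≤⟨ *-monoˡ-≤-0≤ (÷-nonneg 0<aA (0≤ι 1)) ∣g∣≤ ⟩
  (1ℚ ÷ (a * A)) * (a * G₂ * S₃)        ≡⟨ cong ((1ℚ ÷ (a * A)) *_) (sym aA*r≡) ⟩
  (1ℚ ÷ (a * A)) * ((a * A) * r)        ≡⟨ sym (*-assoc (1ℚ ÷ (a * A)) (a * A) r) ⟩
  (1ℚ ÷ (a * A)) * (a * A) * r          ≡⟨ cong (_* r) (÷-*-cancel 1ℚ 0<aA) ⟩
  1ℚ * r                                ≡⟨ *-identityˡ r ⟩
  r                                     ∎
  where
  open ≤-Reasoning
  0<aA = 0<* 0<a 0<A
  r = (G₂ ÷ A) * S₃
  aA*r≡ : (a * A) * r ≡ a * G₂ * S₃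
  aA*r≡ = begin-equality
    (a * A) * ((G₂ ÷ A) * S₃)   ≡⟨ *-assoc a A _ ⟩
    a * (A * ((G₂ ÷ A) * S₃))   ≡⟨ cong (a *_) (sym (*-assoc A (G₂ ÷ A) S₃)) ⟩
    a * ((A * (G₂ ÷ A)) * S₃)   ≡⟨ cong (λ x → a * (x * S₃)) (trans (*-comm A (G₂ ÷ A)) (÷-*-cancel G₂ 0<A)) ⟩
    a * (G₂ * S₃)               ≡⟨ sym (*-assoc a G₂ S₃) ⟩
    a * G₂ * S₃                 ∎

lemma15 : (z₀ z : ℚ) → ι 2 ≤ z₀ → ι 1 ≤ z →
    (τ : ℕ) → NonZero τ → Coprime τ (P z₀) →
    (q : ℕ) → NonZero q →
    ∣ w q z z₀ τ * G τ z z₀ ∣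
      ≤ (G τ (z * z) z₀ ÷ G τ z z₀)
        * Σ₃ q (λ q₁ q₂ q₃ → (ℕ._*_ q₁ q₃ ≤ℚ z) ∧ (ℕ._*_ q₂ q₃ ≤ℚ z))
               (λ q₁ q₂ q₃ → 1ℚ ÷ ι (ℕ._*_ (ℕ._*_ q₁ q₂) q₃))
lemma15 z₀ z _ 1≤z τ _ _ q q≢0 = T-case (squarefree q ∧ coprimeᵇ q (τ ℕ.* P z₀)) main trivial
  where
  1≤q = ℕ.>-nonZero⁻¹ q {{q≢0}}
  A = G τ z z₀
  RHS = (G τ (z * z) z₀ ÷ A) * Σ₃ q (below z) (λ a b d → 1ℚ ÷ ι (a ℕ.* b ℕ.* d))
  main : T (squarefree q ∧ coprimeᵇ q (τ ℕ.* P z₀)) → ∣ w q z z₀ τ * A ∣ ≤ RHS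
  main t = let (sq , q⊥S) = Equivalence.to (T-∧ {squarefree q}) t in
    subst (λ x → ∣ x * A ∣ ≤ RHS) (sym (w-selected q z z₀ τ t))
      (quotient-bound (∣μℚ∣≤1 q) (0<ι (φ-pos 1≤q)) (0<G τ z₀ 1≤z)
        (GqBound.∣G[q]∣≤ z₀ z τ q 1≤z 1≤q (squarefree⇒SquareFree 1≤q sq) (coprimeᵇ⇒Coprime {q} q⊥S)))
  trivial : ¬ T (squarefree q ∧ coprimeᵇ q (τ ℕ.* P z₀)) → ∣ w q z z₀ τ * A ∣ ≤ RHS
  trivial ¬t = subst (_≤ RHS) (sym (trans (cong (λ x → ∣ x * A ∣) (w-discarded q z z₀ τ ¬t)) (cong ∣_∣ (*-zeroˡ A))))
    (0≤* (÷-nonneg (0<G τ z₀ 1≤z) (0≤G τ (z * z) z₀)) (0≤Σ₃-reciprocals 1≤q))
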